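{- Let $k\geq 3$ and $1\leq t<k$, and let $S$ be a nonempty set of $k$-tuples with $S\subseteq \{0,1\}^k\setminus(\mathbf{I}_{t,k}\cup\{0^k,1^k\})$, i.e. $S$ contains no tuple of weight $t$ and neither all-equal tuple. If $t$ is odd, $k$ is even, and every tuple in $S$ has odd weight, then $\mathrm{PCSP}(\mathbf{I}_{t,k}\cup S,\mathbf{NAE}_k)$ is solved by $\mathrm{AIP}$. Otherwise, $\mathrm{PCSP}(\mathbf{I}_{t,k}\cup S,\mathbf{NAE}_k)$ is not solved by $\mathrm{BLP}+\mathrm{AIP}$.
   Context: A relational structure $\mathbf{A}=(A;R_1,\dots,R_p)$ has a finite domain $A$ and nonempty relations $R_i\subseteq A^{\mathrm{ar}(R_i)}$. A homomorphism $\mathbf{A}\to\mathbf{B}$ between structures of the same signature is a map $A\to B$ sending each tuple of each $R_i$ (componentwise) into the corresponding relation $S_i$ of $\mathbf{B}$. A PCSP template is a pair $(\mathbf{A},\mathbf{B})$ with $\mathbf{A}\to\mathbf{B}$; $\mathrm{PCSP}(\mathbf{A},\mathbf{B})$ (decision) asks, given $\mathbf{X}$, to answer Yes if $\mathbf{X}\to\mathbf{A}$ and No if $\mathbf{X}\not\to\mathbf{B}$. The weight of $x\in\{0,1\}^k$ is its number of 1's. $\mathbf{I}_{t,k}$ is the Boolean structure with one $k$-ary relation consisting of all tuples of weight exactly $t$; $\mathbf{I}_{t,k}\cup S$ is the Boolean structure whose single relation is that relation together with the tuples of $S$. $\mathbf{NAE}_k$ is the Boolean structure with one $k$-ary relation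 $\{0,1\}^k\setminus\{0^k,1^k\}$. Relaxations: write $\mathbf{A}=(A;R_1,\dots,R_p)$, $\mathbf{X}=(X;T_1,\dots,T_p)$ and assume w.l.o.g. all structures contain a unary relation equal to the whole domain (called $R_u$ in $\mathbf{A}$). $\mathrm{BLP}(\mathbf{X},\mathbf{A})$ has real variables $\lambda_{x,i}(a)$ for $i\in[p]$, $x\in T_i$, $a\in R_i$, with constraints $0\le\lambda_{x,i}(a)\le1$, $\sum_{a\in R_i}\lambda_{x,i}(a)=1$, and $\sum_{a\in R_i,a_j=c}\lambda_{x,i}(a)=\lambda_{x_j,R_u}(c)$ for all $i,x\in T_i,c\in A,j\in[\mathrm{ar}(R_i)]$. $\mathrm{AIP}(\mathbf{X},\mathbf{A})$ is the same system with integer variables $\tau_{x,i}(a)\in\mathbb{Z}$ instead (no bounds $[0,1]$); it accepts iff feasible. $\mathrm{AIP}$ solves $\mathrm{PCSP}(\mathbf{A},\mathbf{B})$ if every $\mathbf{X}$ accepted by $\mathrm{AIP}(\mathbf{X},\mathbf{A})$ satisfies $\mathbf{X}\to\mathbf{B}$. The $\mathrm{BLP}+\mathrm{AIP}$ algorithm on input $\mathbf{X}$: find a relative interior point $\lambda$ of the polytope $\mathrm{BLP}(\mathbf{X},\mathbf{A})$; if none exists answer No; otherwise add to $\mathrm{AIP}(\mathbf{X},\mathbf{A})$ the constraints $\tau_{x,i}(a)=0$ whenever $\lambda_{x,i}(a)=0$, and answer Yes iff this refined system is feasible. $\mathrm{BLP}+\mathrm{AIP}$ solves $\mathrm{PCSP}(\mathbf{A},\mathbf{B})$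 if every accepted $\mathbf{X}$ satisfies $\mathbf{X}\to\mathbf{B}$.
   Formalization: The variables of the BLP relaxation, including the relative interior point used by the BLP+AIP algorithm, take values in the rationals rather than the reals. -}

module Defs where

open import Data.Bool using (Bool; true; false; if_then_else_; _∧_; _∨_)
open import Data.Nat as ℕ using (ℕ; zero; suc; _%_)
open import Data.Fin using (Fin)
open import Data.Vec using (Vec; []; _∷_; lookup; replicate; map)
open import Data.List using (List; [_]; _++_; foldr) renaming (map to lmap)
open import Data.Product using (Σ; ∃; _×_)
open import Relation.Binary.PropositionalEquality using (_≡_; _≢_)
open import Relation.Nullary using (¬_)
open import Data.Rational as ℚ using (ℚ; 0ℚ; 1ℚ)
open import Data.Integer as ℤ using (ℤ)

allVecs : (k : ℕ) → List (Vec Bool k)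
allVecs zero = [ [] ]
allVecs (suc k) = lmap (false ∷_) (allVecs k) ++ lmap (true ∷_) (allVecs k)

weight : {k : ℕ} → Vec Bool k → ℕ
weight [] = 0
weight (true ∷ v) = suc (weight v)
weight (false ∷ v) = weight v

Even : ℕ → Set
Even n = n % 2 ≡ 0

Odd : ℕ → Set
Odd n = n % 2 ≡ 1

beq : Bool → Bool → Bool
beq true true = true
beq false false = true
beq _ _ = false

natEq : ℕ → ℕ → Bool
natEq zero zero = true
natEq (suc m) (suc n) = natEq m n
natEq _ _ = false

BRel : ℕ → Set
BRel k = Vec Bool k → Bool

IUnion : (k t : ℕ) → BRel k → BRel k
IUnion k t S a = natEq (weight a) t ∨ S a

NAE : {k : ℕ} → Vec Bool k → Set
NAE {k} v = (v ≢ replicate k false) × (v ≢ replicate k true)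

HomToNAE : {k n : ℕ} → (Vec (Fin n) k → Set) → Set
HomToNAE {k} {n} T = ∃ λ (f : Fin n → Bool) → ∀ x → T x → NAE (map f x)

sumℚ : {k : ℕ} → BRel k → (Vec Bool k → ℚ) → ℚ
sumℚ {k} P f = foldr (λ a s → if P a then f a ℚ.+ s else s) 0ℚ (allVecs k)

sumℤ : {k : ℕ} → BRel k → (Vec Bool k → ℤ) → ℤ
sumℤ {k} P f = foldr (λ a s → if P a then f a ℤ.+ s else s) (ℤ.+ 0) (allVecs k)

-- BLP(X, A) for A = ({0,1}; R, R_u) and X = (Fin n; T, Fin n).
-- lam x a  = λ_{x,R}(a)   (meaningful for T x, R a)
-- mu  y c  = λ_{y,R_u}(c)

record BLPSol {k n : ℕ} (R : BRel k) (T : Vec (Fin n) k → Set)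
              (lam : Vec (Fin n) k → Vec Bool k → ℚ) (mu : Fin n → Bool → ℚ) : Set where
  field
    lam-lo  : ∀ x → T x → ∀ a → R a ≡ true → 0ℚ ℚ.≤ lam x a
    lam-hi  : ∀ x → T x → ∀ a → R a ≡ true → lam x a ℚ.≤ 1ℚ
    mu-lo   : ∀ y c → 0ℚ ℚ.≤ mu y c
    mu-hi   : ∀ y c → mu y c ℚ.≤ 1ℚ
    lam-sum : ∀ x → T x → sumℚ R (lam x) ≡ 1ℚ
    mu-sum  : ∀ y → mu y false ℚ.+ mu y true ≡ 1ℚ
    marg    : ∀ x → T x → ∀ (j : Fin k) (c : Bool) →
              sumℚ (λ a → R a ∧ beq (lookup a j) c) (lam x) ≡ mu (lookup x j) c

record AIPSol {k n : ℕ} (R : BRel k) (T : Vec (Fin n) k → Set)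
              (tau : Vec (Fin n) k → Vec Bool k → ℤ) (nu : Fin n → Bool → ℤ) : Set where
  field
    tau-sum : ∀ x → T x → sumℤ R (tau x) ≡ ℤ.+ 1
    nu-sum  : ∀ y → nu y false ℤ.+ nu y true ≡ ℤ.+ 1
    marg    : ∀ x → T x → ∀ (j : Fin k) (c : Bool) →
              sumℤ (λ a → R a ∧ beq (lookup a j) c) (tau x) ≡ nu (lookup x j) c

-- A relative interior point of the BLP polytope: a feasible point whose
-- support contains the support of every feasible point.
RelInt : {k n : ℕ} (R : BRel k) (T : Vec (Fin n) k → Set)
         (lam : Vec (Fin n) k → Vec Bool k → ℚ) (mu : Fin n → Bool → ℚ) → Set
RelInt {k} {n} R T lam mu =
  BLPSol R T lam mu ×
  (∀ lam' mu' → BLPSol R T lam' mu' →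
     (∀ x → T x → ∀ a → R a ≡ true → lam' x a ≢ 0ℚ → lam x a ≢ 0ℚ) ×
     (∀ y c → mu' y c ≢ 0ℚ → mu y c ≢ 0ℚ))

AIPAccepts : {k n : ℕ} → BRel k → (Vec (Fin n) k → Set) → Set
AIPAccepts {k} {n} R T = ∃ λ tau → ∃ λ nu → AIPSol {k} {n} R T tau nu

BLPAIPAccepts : {k n : ℕ} → BRel k → (Vec (Fin n) k → Set) → Set
BLPAIPAccepts {k} {n} R T =
  ∃ λ lam → ∃ λ mu → RelInt R T lam mu ×
    (∃ λ tau → ∃ λ nu → AIPSol {k} {n} R T tau nu ×
      (∀ x → T x → ∀ a → R a ≡ true → lam x a ≡ 0ℚ → tau x a ≡ ℤ.+ 0) ×
      (∀ y c → mu y c ≡ 0ℚ → nu y c ≡ ℤ.+ 0))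

AIPSolves : (k : ℕ) → BRel k → Set₁
AIPSolves k R = ∀ (n : ℕ) (T : Vec (Fin n) k → Set) → AIPAccepts R T → HomToNAE T

BLPAIPSolves : (k : ℕ) → BRel k → Set₁
BLPAIPSolves k R = ∀ (n : ℕ) (T : Vec (Fin n) k → Set) → BLPAIPAccepts R T → HomToNAE T

{-# OPTIONS --safe #-}
module Submission where

-- If t is odd, k is even and S has only odd weights, every tuple of the template has odd weight.
-- Summing the AIP marginal equations of a constraint x then gives
-- ∑ⱼ ν(xⱼ) = ∑ₐ weight(a) τₓ(a) ≡ ∑ₐ τₓ(a) = 1 (mod 2), so colouring each variable by the parity
-- of ν puts an odd number of 1s on the k positions of x, and k is even.
--
-- Otherwise fix s ∈ S and d = weight s − t ≠ 0. The BLP has a point of full support, the same for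
-- every instance: the uniform weight on I_{t,k} has equal marginals, and the marginals of S are
-- equalised by moving mass between weight-t tuples that differ in two coordinates. Hence BLP+AIP
-- accepts whatever AIP accepts. The same moves show that AIP accepts every instance carrying an
-- integer value on each variable whose sum over each constraint is ≡ t (mod d). For three variables
-- with values c, c+1, c+2 and, for each pair of them, a constraint made of two blocks, this can be
-- arranged when t is even, when s has even weight (c = 0 in both cases) or when k and t are odd
-- (c = −1); but any 2-colouring of three variables makes one of the three constraints constant.

open import Defs
open import Data.Bool using (Bool; true; false)
open import Data.Nat using (ℕ; _≤_; _<_)
open import Data.Vec using (Vec; replicate)
open import Data.Product using (∃; _×_)
open import Relation.Binary.PropositionalEquality using (_≡_; _≢_)
open import Relation.Nullary using (¬_)

open import Data.Bool using (_∧_; _∨_; if_then_else_)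
open import Data.Bool.Properties using (∨-zeroʳ)
open import Data.Empty using (⊥-elim)
open import Data.Fin using (Fin; zero; suc; toℕ; punchIn; punchOut)
open import Data.Fin.Patterns using (0F; 1F; 2F)
import Data.Fin.Properties as FinP
open import Data.Integer as ℤ using (ℤ; +_; 0ℤ; 1ℤ; _+_; _*_; -_; _-_)
open import Data.Integer.Divisibility.Signed using (_∣_; divides; quotient; _∣?_; ∣-refl)
import Data.Integer.DivMod as ℤDM
import Data.Integer.Properties as ℤP
open import Data.Integer.Tactic.RingSolver using (solve-∀)
open import Data.List using ([]; _∷_; foldr; _++_) renaming (map to mapᴸ)
open import Data.List.Properties using (foldr-++; foldr-map)
open import Data.Nat as ℕ using (zero; suc; s≤s)
import Data.Nat.DivMod as ℕDM
import Data.Nat.Properties as ℕP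
open import Data.Product using (_,_; proj₁; proj₂)
open import Data.Rational as ℚ using (ℚ; 0ℚ; 1ℚ; 1/_)
open import Data.Rational.Literals using (fromℤ)
import Data.Rational.Properties as ℚP
open import Data.Sum using (_⊎_; inj₁; inj₂)
open import Data.Vec using ([]; _∷_; lookup; map; insertAt)
open import Data.Vec.Properties using (lookup-map; lookup-replicate; insertAt-lookup; insertAt-punchIn)
open import Function using (_∘_)
open import Relation.Binary.PropositionalEquality
  using (refl; sym; trans; cong; cong₂; subst; subst₂; module ≡-Reasoning)
open import Relation.Nullary using (Dec; yes; no)
open import Algebra.Properties.CommutativeSemigroup ℤP.+-commutativeSemigroup
  using () renaming (interchange to +-interchange)
open import Algebra.Properties.Semiring.Sum ℤP.+-*-semiring
  using (sum; sum-syntax; sum-cong-≗; sum-replicate-zero; ∑-distrib-+; *-distribˡ-sum; *-distribʳ-sum)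
open ≡-Reasoning

⟦_⟧ : Bool → ℤ
⟦ true ⟧ = 1ℤ
⟦ false ⟧ = 0ℤ

0≤⟦⟧ : ∀ b → 0ℤ ℤ.≤ ⟦ b ⟧
0≤⟦⟧ true = ℤ.+≤+ ℕ.z≤n
0≤⟦⟧ false = ℤ.+≤+ ℕ.z≤n

0≤⟦⟧* : ∀ b x → (b ≡ true → 0ℤ ℤ.≤ x) → 0ℤ ℤ.≤ ⟦ b ⟧ * x
0≤⟦⟧* true x 0≤x = subst (0ℤ ℤ.≤_) (sym (ℤP.*-identityˡ x)) (0≤x refl)
0≤⟦⟧* false x _ = ℤP.≤-reflexive (sym (ℤP.*-zeroˡ x))

1≤⇒0≤ : ∀ {x} → 1ℤ ℤ.≤ x → 0ℤ ℤ.≤ x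
1≤⇒0≤ = ℤP.≤-trans (ℤ.+≤+ ℕ.z≤n)

1≤⇒≢0 : ∀ {x} → 1ℤ ℤ.≤ x → x ≢ 0ℤ
1≤⇒≢0 (ℤ.+≤+ ()) refl

1≤⇒suc : ∀ {x} → 1ℤ ℤ.≤ x → ∃ λ z → x ≡ + suc z
1≤⇒suc {+ suc z} _ = z , refl
1≤⇒suc {+ zero} (ℤ.+≤+ ())

i≤[1+k]*i : ∀ k₁ {i} → 0ℤ ℤ.≤ i → i ℤ.≤ + suc k₁ * i
i≤[1+k]*i k₁ {i} 0≤i = subst (i ℤ.≤_) (i+k*i≡[1+k]*i i (+ k₁)) (ℤP.i≤i+j i (+ k₁ * i) {{ℤ.nonNegative 0≤k*i}})
  where
  0≤k*i : 0ℤ ℤ.≤ + k₁ * i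
  0≤k*i = subst (ℤ._≤ + k₁ * i) (ℤP.*-zeroʳ (+ k₁)) (ℤP.*-monoˡ-≤-nonNeg (+ k₁) 0≤i)
  i+k*i≡[1+k]*i : ∀ i k → i + k * i ≡ (+ 1 + k) * i
  i+k*i≡[1+k]*i = solve-∀

-∣x∣≤x*[⟦b⟧-⟦c⟧] : ∀ x b c → - + ℤ.∣ x ∣ ℤ.≤ x * (⟦ b ⟧ - ⟦ c ⟧)
-∣x∣≤x*[⟦b⟧-⟦c⟧] x true true = subst (- + ℤ.∣ x ∣ ℤ.≤_) (sym (ℤP.*-zeroʳ x)) ℤP.neg-≤-pos
-∣x∣≤x*[⟦b⟧-⟦c⟧] x false false = subst (- + ℤ.∣ x ∣ ℤ.≤_) (sym (ℤP.*-zeroʳ x)) ℤP.neg-≤-pos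
-∣x∣≤x*[⟦b⟧-⟦c⟧] x true false = subst (- + ℤ.∣ x ∣ ℤ.≤_) (sym (ℤP.*-identityʳ x)) (-∣x∣≤x x)
  where
  -∣x∣≤x : ∀ x → - + ℤ.∣ x ∣ ℤ.≤ x
  -∣x∣≤x (+ n) = ℤP.neg-≤-pos
  -∣x∣≤x ℤ.-[1+ n ] = ℤP.≤-refl
-∣x∣≤x*[⟦b⟧-⟦c⟧] x false true = subst (- + ℤ.∣ x ∣ ℤ.≤_) (x*-1≡-x x) (-∣x∣≤-x x)
  where
  -∣x∣≤-x : ∀ x → - + ℤ.∣ x ∣ ℤ.≤ - x
  -∣x∣≤-x (+ n) = ℤP.≤-refl
  -∣x∣≤-x ℤ.-[1+ n ] = ℤP.neg-≤-pos
  x*-1≡-x : ∀ x → - x ≡ x * (+ 0 - + 1)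
  x*-1≡-x = solve-∀

even≢odd : ∀ a b → + 2 * a ≢ 1ℤ + + 2 * b
even≢odd a b 2a≡1+2b = ℕP.even≢odd ℤ.∣ a - b ∣ 0 (trans (sym (ℤP.abs-* (+ 2) (a - b))) (cong ℤ.∣_∣ 2[a-b]≡1))
  where
  2[a-b]≡1 : + 2 * (a - b) ≡ 1ℤ
  2[a-b]≡1 = trans (2[a-b]≡2a-2b a b) (trans (cong (_- + 2 * b) 2a≡1+2b) (1+2b-2b≡1 b))
    where
    2[a-b]≡2a-2b : ∀ a b → + 2 * (a - b) ≡ + 2 * a - + 2 * b
    2[a-b]≡2a-2b = solve-∀
    1+2b-2b≡1 : ∀ b → (+ 1 + + 2 * b) - + 2 * b ≡ + 1
    1+2b-2b≡1 = solve-∀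

natEq-sound : ∀ m n → natEq m n ≡ true → m ≡ n
natEq-sound zero zero _ = refl
natEq-sound (suc m) (suc n) eq = cong suc (natEq-sound m n eq)

natEq-refl : ∀ n → natEq n n ≡ true
natEq-refl zero = refl
natEq-refl (suc n) = natEq-refl n

beq-true : ∀ x → beq x true ≡ x
beq-true true = refl
beq-true false = refl

odd-split : ∀ n → Odd n → n ≡ suc (2 ℕ.* (n ℕ./ 2))
odd-split n odd = trans (ℕDM.m≡m%n+[m/n]*n n 2) (cong₂ ℕ._+_ odd (ℕP.*-comm (n ℕ./ 2) 2))

even-split : ∀ n → Even n → n ≡ 2 ℕ.* (n ℕ./ 2)
even-split n even = trans (ℕDM.m≡m%n+[m/n]*n n 2) (cong₂ ℕ._+_ even (ℕP.*-comm (n ℕ./ 2) 2))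

even-or-odd : ∀ n → n ℕ.% 2 ≡ 0 ⊎ n ℕ.% 2 ≡ 1
even-or-odd n with n ℕ.% 2 | ℕDM.m%n<n n 2
... | 0 | _ = inj₁ refl
... | 1 | _ = inj₂ refl
... | suc (suc _) | s≤s (s≤s ())

2*[n/2]≡n : ∀ n → Even n → + 2 * + (n ℕ./ 2) ≡ + n
2*[n/2]≡n n n-even = trans (sym (ℤP.pos-* 2 (n ℕ./ 2))) (cong +_ (sym (even-split n n-even)))

weight≤ : ∀ {n} (v : Vec Bool n) → weight v ≤ n
weight≤ [] = ℕ.z≤n
weight≤ (true ∷ v) = s≤s (weight≤ v)
weight≤ (false ∷ v) = ℕP.m≤n⇒m≤1+n (weight≤ v)

weight-insertAt : ∀ {m} (e : Vec Bool m) p b → weight (insertAt e p b) ≡ weight (b ∷ e)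
weight-insertAt e zero b = refl
weight-insertAt (true ∷ e) (suc p) b = trans (cong suc (weight-insertAt e p b)) (suc-weight-∷ b)
  where
  suc-weight-∷ : ∀ b → suc (weight (b ∷ e)) ≡ weight (b ∷ true ∷ e)
  suc-weight-∷ true = refl
  suc-weight-∷ false = refl
weight-insertAt (false ∷ e) (suc p) b = trans (weight-insertAt e p b) (weight-∷ b)
  where
  weight-∷ : ∀ b → weight (b ∷ e) ≡ weight (b ∷ false ∷ e)
  weight-∷ true = refl
  weight-∷ false = refl

lookup-insertAt-≢ : ∀ {A : Set} {m} (e : Vec A m) p i (x y : A) →
  p ≢ i → lookup (insertAt e p x) i ≡ lookup (insertAt e p y) i
lookup-insertAt-≢ e p i x y p≢i = begin
  lookup (insertAt e p x) i                            ≡⟨ cong (lookup (insertAt e p x)) (sym (FinP.punchIn-punchOut p≢i)) ⟩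
  lookup (insertAt e p x) (punchIn p (punchOut p≢i))   ≡⟨ insertAt-punchIn e p x (punchOut p≢i) ⟩
  lookup e (punchOut p≢i)                              ≡⟨ sym (insertAt-punchIn e p y (punchOut p≢i)) ⟩
  lookup (insertAt e p y) (punchIn p (punchOut p≢i))   ≡⟨ cong (lookup (insertAt e p y)) (FinP.punchIn-punchOut p≢i) ⟩
  lookup (insertAt e p y) i                            ∎

blocks : ∀ {A : Set} n → ℕ → A → A → Vec A n
blocks zero i a b = []
blocks (suc n) zero a b = b ∷ blocks n zero a b
blocks (suc n) (suc i) a b = a ∷ blocks n i a b

weight-blocks : ∀ {n i} → i ≤ n → weight (blocks n i true false) ≡ i
weight-blocks {zero} ℕ.z≤n = refl
weight-blocks {suc n} ℕ.z≤n = weight-blocks {n} ℕ.z≤n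
weight-blocks (s≤s i≤n) = cong suc (weight-blocks i≤n)

map-blocks-constant : ∀ {A B : Set} (f : A → B) n i a b → f a ≡ f b → map f (blocks n i a b) ≡ replicate n (f b)
map-blocks-constant f zero i a b fa≡fb = refl
map-blocks-constant f (suc n) zero a b fa≡fb = cong (f b ∷_) (map-blocks-constant f n zero a b fa≡fb)
map-blocks-constant f (suc n) (suc i) a b fa≡fb = cong₂ _∷_ fa≡fb (map-blocks-constant f n i a b fa≡fb)

∑-const : ∀ n x → ∑[ i < n ] x ≡ + n * x
∑-const zero x = sym (ℤP.*-zeroˡ x)
∑-const (suc n) x = trans (cong (_+_ x) (∑-const n x)) (x+n*x≡[1+n]*x x (+ n))
  where
  x+n*x≡[1+n]*x : ∀ x n → x + n * x ≡ (+ 1 + n) * x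
  x+n*x≡[1+n]*x = solve-∀

∑-neg : ∀ {n} (f : Fin n → ℤ) → ∑[ i < n ] (- f i) ≡ - ∑[ i < n ] f i
∑-neg {zero} f = refl
∑-neg {suc n} f = trans (cong (_+_ (- f zero)) (∑-neg (f ∘ suc))) (sym (ℤP.neg-distrib-+ (f zero) (sum (f ∘ suc))))

∑-mono-≤ : ∀ {n} {f g : Fin n → ℤ} → (∀ i → f i ℤ.≤ g i) → sum f ℤ.≤ sum g
∑-mono-≤ {zero} f≤g = ℤP.≤-refl
∑-mono-≤ {suc n} f≤g = ℤP.+-mono-≤ (f≤g zero) (∑-mono-≤ (f≤g ∘ suc))

∑-point : ∀ {n} (f : Fin n → ℤ) (i : Fin n) → (∀ j → j ≢ i → f j ≡ 0ℤ) → sum f ≡ f i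
∑-point {suc n} f zero vanish = begin
  f zero + ∑[ j < n ] f (suc j)   ≡⟨ cong (_+_ (f zero)) (sum-cong-≗ (λ j → vanish (suc j) λ ())) ⟩
  f zero + ∑[ j < n ] 0ℤ          ≡⟨ cong (_+_ (f zero)) (sum-replicate-zero n) ⟩
  f zero + 0ℤ                     ≡⟨ ℤP.+-identityʳ (f zero) ⟩
  f zero                          ∎
∑-point {suc n} f (suc i) vanish = begin
  f zero + ∑[ j < n ] f (suc j)   ≡⟨ cong (_+ sum (f ∘ suc)) (vanish zero λ ()) ⟩
  0ℤ + ∑[ j < n ] f (suc j)       ≡⟨ ℤP.+-identityˡ _ ⟩
  ∑[ j < n ] f (suc j)            ≡⟨ ∑-point (f ∘ suc) i (λ j j≢i → vanish (suc j) (j≢i ∘ FinP.suc-injective)) ⟩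
  f (suc i)                       ∎

∑-weight : ∀ {k} (a : Vec Bool k) → ∑[ j < k ] ⟦ lookup a j ⟧ ≡ + weight a
∑-weight [] = refl
∑-weight (true ∷ a) = cong (_+_ 1ℤ) (∑-weight a)
∑-weight (false ∷ a) = trans (ℤP.+-identityˡ _) (∑-weight a)

∑-blocks : ∀ {A : Set} (g : A → ℤ) {n i} a b → i ≤ n →
  ∑[ j < n ] g (lookup (blocks n i a b) j) ≡ + n * g b + + i * (g a - g b)
∑-blocks g {zero} a b ℕ.z≤n = refl
∑-blocks g {suc n} a b ℕ.z≤n = trans (cong (_+_ (g b)) (∑-blocks g {n} a b ℕ.z≤n)) (y+[ny+0]≡[1+n]y+0 (g a) (g b) (+ n))
  where
  y+[ny+0]≡[1+n]y+0 : ∀ x y n → y + (n * y + + 0 * (x - y)) ≡ (+ 1 + n) * y + + 0 * (x - y)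
  y+[ny+0]≡[1+n]y+0 = solve-∀
∑-blocks g {suc n} {suc i} a b (s≤s i≤n) =
  trans (cong (_+_ (g a)) (∑-blocks g a b i≤n)) (x+[ny+i[x-y]]≡[1+n]y+[1+i][x-y] (g a) (g b) (+ n) (+ i))
  where
  x+[ny+i[x-y]]≡[1+n]y+[1+i][x-y] : ∀ x y n i → x + (n * y + i * (x - y)) ≡ (+ 1 + n) * y + (+ 1 + i) * (x - y)
  x+[ny+i[x-y]]≡[1+n]y+[1+i][x-y] = solve-∀

∑ᵛ : ∀ {k} → (Vec Bool k → ℤ) → ℤ
∑ᵛ {zero} f = f []
∑ᵛ {suc k} f = ∑ᵛ (f ∘ (false ∷_)) + ∑ᵛ (f ∘ (true ∷_))

∑ᵛ-cong : ∀ {k} {f g : Vec Bool k → ℤ} → (∀ a → f a ≡ g a) → ∑ᵛ f ≡ ∑ᵛ g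
∑ᵛ-cong {zero} f≗g = f≗g []
∑ᵛ-cong {suc k} f≗g = cong₂ _+_ (∑ᵛ-cong (f≗g ∘ (false ∷_))) (∑ᵛ-cong (f≗g ∘ (true ∷_)))

∑ᵛ-zero : ∀ {k} → ∑ᵛ {k} (λ _ → 0ℤ) ≡ 0ℤ
∑ᵛ-zero {zero} = refl
∑ᵛ-zero {suc k} = cong₂ _+_ (∑ᵛ-zero {k}) (∑ᵛ-zero {k})

∑ᵛ-distrib-+ : ∀ {k} (f g : Vec Bool k → ℤ) → ∑ᵛ (λ a → f a + g a) ≡ ∑ᵛ f + ∑ᵛ g
∑ᵛ-distrib-+ {zero} f g = refl
∑ᵛ-distrib-+ {suc k} f g =
  trans (cong₂ _+_ (∑ᵛ-distrib-+ (f ∘ (false ∷_)) (g ∘ (false ∷_)))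
                   (∑ᵛ-distrib-+ (f ∘ (true ∷_)) (g ∘ (true ∷_))))
        (+-interchange (∑ᵛ (f ∘ (false ∷_))) (∑ᵛ (g ∘ (false ∷_))) (∑ᵛ (f ∘ (true ∷_))) (∑ᵛ (g ∘ (true ∷_))))

*-distribˡ-∑ᵛ : ∀ {k} x (f : Vec Bool k → ℤ) → ∑ᵛ (λ a → x * f a) ≡ x * ∑ᵛ f
*-distribˡ-∑ᵛ {zero} x f = refl
*-distribˡ-∑ᵛ {suc k} x f =
  trans (cong₂ _+_ (*-distribˡ-∑ᵛ x (f ∘ (false ∷_))) (*-distribˡ-∑ᵛ x (f ∘ (true ∷_))))
        (sym (ℤP.*-distribˡ-+ x (∑ᵛ (f ∘ (false ∷_))) (∑ᵛ (f ∘ (true ∷_)))))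

∑ᵛ-∑ : ∀ {k n} (f : Fin n → Vec Bool k → ℤ) → ∑ᵛ (λ a → ∑[ i < n ] f i a) ≡ ∑[ i < n ] ∑ᵛ (f i)
∑ᵛ-∑ {zero} f = refl
∑ᵛ-∑ {suc k} f =
  trans (cong₂ _+_ (∑ᵛ-∑ (λ i → f i ∘ (false ∷_))) (∑ᵛ-∑ (λ i → f i ∘ (true ∷_))))
        (sym (∑-distrib-+ (λ i → ∑ᵛ (f i ∘ (false ∷_))) (λ i → ∑ᵛ (f i ∘ (true ∷_)))))

∑ᵛ-distrib-- : ∀ {k} (f g : Vec Bool k → ℤ) → ∑ᵛ (λ a → f a - g a) ≡ ∑ᵛ f - ∑ᵛ g
∑ᵛ-distrib-- f g = begin
  ∑ᵛ (λ a → f a - g a)            ≡⟨ ∑ᵛ-distrib-+ f (λ a → - g a) ⟩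
  ∑ᵛ f + ∑ᵛ (λ a → - g a)         ≡⟨ cong (_+_ (∑ᵛ f)) (∑ᵛ-cong (λ a → sym (ℤP.-1*i≡-i (g a)))) ⟩
  ∑ᵛ f + ∑ᵛ (λ a → ℤ.-1ℤ * g a)   ≡⟨ cong (_+_ (∑ᵛ f)) (*-distribˡ-∑ᵛ ℤ.-1ℤ g) ⟩
  ∑ᵛ f + ℤ.-1ℤ * ∑ᵛ g             ≡⟨ cong (_+_ (∑ᵛ f)) (ℤP.-1*i≡-i (∑ᵛ g)) ⟩
  ∑ᵛ f - ∑ᵛ g                     ∎

0≤∑ᵛ : ∀ {k} (f : Vec Bool k → ℤ) → (∀ a → 0ℤ ℤ.≤ f a) → 0ℤ ℤ.≤ ∑ᵛ f
0≤∑ᵛ {zero} f 0≤f = 0≤f []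
0≤∑ᵛ {suc k} f 0≤f =
  ℤP.+-mono-≤ (0≤∑ᵛ (f ∘ (false ∷_)) (0≤f ∘ (false ∷_))) (0≤∑ᵛ (f ∘ (true ∷_)) (0≤f ∘ (true ∷_)))

term≤∑ᵛ : ∀ {k} (f : Vec Bool k → ℤ) → (∀ a → 0ℤ ℤ.≤ f a) → ∀ b → f b ℤ.≤ ∑ᵛ f
term≤∑ᵛ {zero} f 0≤f [] = ℤP.≤-refl
term≤∑ᵛ {suc k} f 0≤f (false ∷ b) =
  ℤP.≤-trans (ℤP.≤-reflexive (sym (ℤP.+-identityʳ (f (false ∷ b)))))
             (ℤP.+-mono-≤ (term≤∑ᵛ (f ∘ (false ∷_)) (0≤f ∘ (false ∷_)) b)
                          (0≤∑ᵛ (f ∘ (true ∷_)) (0≤f ∘ (true ∷_))))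
term≤∑ᵛ {suc k} f 0≤f (true ∷ b) =
  ℤP.≤-trans (ℤP.≤-reflexive (sym (ℤP.+-identityˡ (f (true ∷ b)))))
             (ℤP.+-mono-≤ (0≤∑ᵛ (f ∘ (false ∷_)) (0≤f ∘ (false ∷_)))
                          (term≤∑ᵛ (f ∘ (true ∷_)) (0≤f ∘ (true ∷_)) b))

_=ᵛ_ : ∀ {k} → Vec Bool k → Vec Bool k → Bool
[] =ᵛ [] = true
(x ∷ a) =ᵛ (y ∷ b) = beq x y ∧ (a =ᵛ b)

=ᵛ-sound : ∀ {k} (a b : Vec Bool k) → a =ᵛ b ≡ true → a ≡ b
=ᵛ-sound [] [] _ = refl
=ᵛ-sound (true ∷ a) (true ∷ b) eq = cong (true ∷_) (=ᵛ-sound a b eq)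
=ᵛ-sound (false ∷ a) (false ∷ b) eq = cong (false ∷_) (=ᵛ-sound a b eq)

δ : ∀ {k} → Vec Bool k → Vec Bool k → ℤ
δ b a = ⟦ a =ᵛ b ⟧

∑ᵛ-δ : ∀ {k} (b : Vec Bool k) (f : Vec Bool k → ℤ) → ∑ᵛ (λ a → δ b a * f a) ≡ f b
∑ᵛ-δ [] f = ℤP.*-identityˡ (f [])
∑ᵛ-δ {suc k} (false ∷ b) f = begin
  ∑ᵛ (λ a → δ b a * f (false ∷ a)) + ∑ᵛ (λ a → 0ℤ * f (true ∷ a))
    ≡⟨ cong₂ _+_ (∑ᵛ-δ b (f ∘ (false ∷_))) (∑ᵛ-cong (λ a → ℤP.*-zeroˡ (f (true ∷ a)))) ⟩
  f (false ∷ b) + ∑ᵛ {k} (λ _ → 0ℤ)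
    ≡⟨ cong (_+_ (f (false ∷ b))) (∑ᵛ-zero {k}) ⟩
  f (false ∷ b) + 0ℤ
    ≡⟨ ℤP.+-identityʳ _ ⟩
  f (false ∷ b) ∎
∑ᵛ-δ {suc k} (true ∷ b) f = begin
  ∑ᵛ (λ a → 0ℤ * f (false ∷ a)) + ∑ᵛ (λ a → δ b a * f (true ∷ a))
    ≡⟨ cong₂ _+_ (∑ᵛ-cong (λ a → ℤP.*-zeroˡ (f (false ∷ a)))) (∑ᵛ-δ b (f ∘ (true ∷_))) ⟩
  ∑ᵛ {k} (λ _ → 0ℤ) + f (true ∷ b)
    ≡⟨ cong (_+ f (true ∷ b)) (∑ᵛ-zero {k}) ⟩
  0ℤ + f (true ∷ b)
    ≡⟨ ℤP.+-identityˡ _ ⟩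
  f (true ∷ b) ∎

δ-outside : ∀ {k} (P : BRel k) b a → P b ≡ true → P a ≡ false → δ b a ≡ 0ℤ
δ-outside P b a Pb Pa with a =ᵛ b in a=b
... | false = refl
... | true with () ← trans (sym Pa) (trans (cong P (=ᵛ-sound a b a=b)) Pb)

∑-ones-symmetric : ∀ {n} (P : ℕ → Bool) (j : Fin (suc n)) →
  ∑ᵛ (λ a → ⟦ lookup a j ∧ P (weight a) ⟧) ≡ ∑ᵛ {n} (λ b → ⟦ P (suc (weight b)) ⟧)
∑-ones-symmetric {n} P zero =
  trans (cong (_+ ∑ᵛ {n} (λ b → ⟦ P (suc (weight b)) ⟧)) (∑ᵛ-zero {n})) (ℤP.+-identityˡ _)
∑-ones-symmetric {suc n} P (suc j) = cong₂ _+_ (∑-ones-symmetric P j) (∑-ones-symmetric (P ∘ suc) j)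

∑⟨_⟩ : ∀ {k} → BRel k → (Vec Bool k → ℤ) → ℤ
∑⟨ Q ⟩ f = ∑ᵛ (λ a → ⟦ Q a ⟧ * f a)

sumℤ≡∑⟨⟩ : ∀ {k} (Q : BRel k) (f : Vec Bool k → ℤ) → sumℤ Q f ≡ ∑⟨ Q ⟩ f
sumℤ≡∑⟨⟩ Q f = trans (foldr≡∑⟨⟩+ Q f 0ℤ) (ℤP.+-identityʳ (∑⟨ Q ⟩ f))
  where
  step : ∀ {k} → BRel k → (Vec Bool k → ℤ) → Vec Bool k → ℤ → ℤ
  step Q f a s = if Q a then f a + s else s
  foldr≡∑⟨⟩+ : ∀ {k} (Q : BRel k) f z → foldr (step Q f) z (allVecs k) ≡ ∑⟨ Q ⟩ f + z
  foldr≡∑⟨⟩+ {zero} Q f z with Q []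
  ... | true = cong (_+ z) (sym (ℤP.*-identityˡ (f [])))
  ... | false = sym (trans (cong (_+ z) (ℤP.*-zeroˡ (f []))) (ℤP.+-identityˡ z))
  foldr≡∑⟨⟩+ {suc k} Q f z = begin
    foldr (step Q f) z (mapᴸ (false ∷_) (allVecs k) ++ mapᴸ (true ∷_) (allVecs k))
      ≡⟨ foldr-++ (step Q f) z (mapᴸ (false ∷_) (allVecs k)) (mapᴸ (true ∷_) (allVecs k)) ⟩
    foldr (step Q f) (foldr (step Q f) z (mapᴸ (true ∷_) (allVecs k))) (mapᴸ (false ∷_) (allVecs k))
      ≡⟨ foldr-map (step Q f) (false ∷_) _ (allVecs k) ⟩
    foldr (step Q₀ f₀) (foldr (step Q f) z (mapᴸ (true ∷_) (allVecs k))) (allVecs k)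
      ≡⟨ cong (λ z′ → foldr (step Q₀ f₀) z′ (allVecs k)) (foldr-map (step Q f) (true ∷_) z (allVecs k)) ⟩
    foldr (step Q₀ f₀) (foldr (step Q₁ f₁) z (allVecs k)) (allVecs k)
      ≡⟨ foldr≡∑⟨⟩+ Q₀ f₀ _ ⟩
    ∑⟨ Q₀ ⟩ f₀ + foldr (step Q₁ f₁) z (allVecs k)
      ≡⟨ cong (_+_ (∑⟨ Q₀ ⟩ f₀)) (foldr≡∑⟨⟩+ Q₁ f₁ z) ⟩
    ∑⟨ Q₀ ⟩ f₀ + (∑⟨ Q₁ ⟩ f₁ + z)
      ≡⟨ sym (ℤP.+-assoc (∑⟨ Q₀ ⟩ f₀) (∑⟨ Q₁ ⟩ f₁) z) ⟩
    ∑⟨ Q ⟩ f + z ∎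
    where
    Q₀ Q₁ : BRel k
    Q₀ = Q ∘ (false ∷_)
    Q₁ = Q ∘ (true ∷_)
    f₀ f₁ : Vec Bool k → ℤ
    f₀ = f ∘ (false ∷_)
    f₁ = f ∘ (true ∷_)

module _ {k} (Q : BRel k) where

  ∑⟨⟩-cong : ∀ {f g : Vec Bool k → ℤ} → (∀ a → Q a ≡ true → f a ≡ g a) → ∑⟨ Q ⟩ f ≡ ∑⟨ Q ⟩ g
  ∑⟨⟩-cong {f} {g} f≡g = ∑ᵛ-cong restricted
    where
    restricted : ∀ a → ⟦ Q a ⟧ * f a ≡ ⟦ Q a ⟧ * g a
    restricted a with Q a in Qa
    ... | true = cong (_*_ 1ℤ) (f≡g a Qa)
    ... | false = refl

  ∑⟨⟩-+ : ∀ (f g : Vec Bool k → ℤ) → ∑⟨ Q ⟩ (λ a → f a + g a) ≡ ∑⟨ Q ⟩ f + ∑⟨ Q ⟩ g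
  ∑⟨⟩-+ f g = trans (∑ᵛ-cong (λ a → ℤP.*-distribˡ-+ ⟦ Q a ⟧ (f a) (g a)))
                    (∑ᵛ-distrib-+ (λ a → ⟦ Q a ⟧ * f a) (λ a → ⟦ Q a ⟧ * g a))

  ∑⟨⟩-* : ∀ x (f : Vec Bool k → ℤ) → ∑⟨ Q ⟩ (λ a → x * f a) ≡ x * ∑⟨ Q ⟩ f
  ∑⟨⟩-* x f = trans (∑ᵛ-cong (λ a → x∙yz≡y∙xz ⟦ Q a ⟧ x (f a)))
                    (*-distribˡ-∑ᵛ x (λ a → ⟦ Q a ⟧ * f a))
    where
    x∙yz≡y∙xz : ∀ x y z → x * (y * z) ≡ y * (x * z)
    x∙yz≡y∙xz = solve-∀

  ∑⟨⟩-neg : ∀ (f : Vec Bool k → ℤ) → ∑⟨ Q ⟩ (λ a → - f a) ≡ - ∑⟨ Q ⟩ f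
  ∑⟨⟩-neg f = begin
    ∑⟨ Q ⟩ (λ a → - f a)          ≡⟨ ∑⟨⟩-cong (λ a _ → sym (ℤP.-1*i≡-i (f a))) ⟩
    ∑⟨ Q ⟩ (λ a → ℤ.-1ℤ * f a)    ≡⟨ ∑⟨⟩-* ℤ.-1ℤ f ⟩
    ℤ.-1ℤ * ∑⟨ Q ⟩ f              ≡⟨ ℤP.-1*i≡-i (∑⟨ Q ⟩ f) ⟩
    - ∑⟨ Q ⟩ f                    ∎

  ∑⟨⟩-δ : ∀ b → ∑⟨ Q ⟩ (δ b) ≡ ⟦ Q b ⟧
  ∑⟨⟩-δ b = trans (∑ᵛ-cong (λ a → ℤP.*-comm ⟦ Q a ⟧ (δ b a))) (∑ᵛ-δ b (λ a → ⟦ Q a ⟧))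

  ∑⟨⟩-∑ : ∀ {n} (f : Fin n → Vec Bool k → ℤ) →
          ∑⟨ Q ⟩ (λ a → ∑[ i < n ] f i a) ≡ ∑[ i < n ] ∑⟨ Q ⟩ (f i)
  ∑⟨⟩-∑ {n} f = trans (∑ᵛ-cong (λ a → *-distribˡ-sum ⟦ Q a ⟧ (λ i → f i a)))
                      (∑ᵛ-∑ (λ i a → ⟦ Q a ⟧ * f i a))

  term≤∑⟨⟩ : ∀ (f : Vec Bool k → ℤ) → (∀ a → Q a ≡ true → 0ℤ ℤ.≤ f a) →
             ∀ b → Q b ≡ true → f b ℤ.≤ ∑⟨ Q ⟩ f
  term≤∑⟨⟩ f 0≤f b Qb =
    subst (ℤ._≤ ∑⟨ Q ⟩ f) f-at-b (term≤∑ᵛ (λ a → ⟦ Q a ⟧ * f a) (λ a → 0≤⟦⟧* (Q a) (f a) (0≤f a)) b)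
    where
    f-at-b : ⟦ Q b ⟧ * f b ≡ f b
    f-at-b rewrite Qb = ℤP.*-identityˡ (f b)

_⇂_≔_ : ∀ {k} → BRel k → Fin k → Bool → BRel k
(R ⇂ j ≔ c) a = R a ∧ beq (lookup a j) c

⇂≔-⊆ : ∀ {k} (R : BRel k) j c a → (R ⇂ j ≔ c) a ≡ true → R a ≡ true
⇂≔-⊆ R j c a Ra∧ with R a
... | true = refl

⟦⇂≔true⟧ : ∀ {k} (R : BRel k) j b → R b ≡ true → ⟦ (R ⇂ j ≔ true) b ⟧ ≡ ⟦ lookup b j ⟧
⟦⇂≔true⟧ R j b Rb rewrite Rb | beq-true (lookup b j) = refl

∑⟨⇂≔false⟩ : ∀ {k} (R : BRel k) j f → ∑⟨ R ⇂ j ≔ false ⟩ f ≡ ∑⟨ R ⟩ f - ∑⟨ R ⇂ j ≔ true ⟩ f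
∑⟨⇂≔false⟩ R j f =
  trans (∑ᵛ-cong split) (∑ᵛ-distrib-- (λ a → ⟦ R a ⟧ * f a) (λ a → ⟦ (R ⇂ j ≔ true) a ⟧ * f a))
  where
  split : ∀ a → ⟦ (R ⇂ j ≔ false) a ⟧ * f a ≡ ⟦ R a ⟧ * f a - ⟦ (R ⇂ j ≔ true) a ⟧ * f a
  split a with R a | lookup a j
  ... | false | _ = refl
  ... | true | true = sym (ℤP.+-inverseʳ (1ℤ * f a))
  ... | true | false = sym (ℤP.+-identityʳ (1ℤ * f a))

∑-marginals : ∀ {k} (R : BRel k) f → ∑[ j < k ] ∑⟨ R ⇂ j ≔ true ⟩ f ≡ ∑⟨ R ⟩ (λ a → + weight a * f a)
∑-marginals {k} R f =
  trans (sym (∑ᵛ-∑ (λ j a → ⟦ (R ⇂ j ≔ true) a ⟧ * f a))) (∑ᵛ-cong count)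
  where
  count : ∀ a → ∑[ j < k ] (⟦ (R ⇂ j ≔ true) a ⟧ * f a) ≡ ⟦ R a ⟧ * (+ weight a * f a)
  count a with R a
  ... | false = sum-replicate-zero k
  ... | true = begin
    ∑[ j < k ] (⟦ beq (lookup a j) true ⟧ * f a)
                                               ≡⟨ sum-cong-≗ (λ j → cong (λ b → ⟦ b ⟧ * f a) (beq-true (lookup a j))) ⟩
    ∑[ j < k ] (⟦ lookup a j ⟧ * f a)          ≡⟨ sym (*-distribʳ-sum (f a) (λ j → ⟦ lookup a j ⟧)) ⟩
    (∑[ j < k ] ⟦ lookup a j ⟧) * f a          ≡⟨ cong (_* f a) (∑-weight a) ⟩
    + weight a * f a                           ≡⟨ sym (ℤP.*-identityˡ _) ⟩
    1ℤ * (+ weight a * f a)                    ∎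

parity : ℤ → Bool
parity z = z ℤ.%ℕ 2 ℕ.≡ᵇ 1

parity-split : ∀ z → z ≡ ⟦ parity z ⟧ + + 2 * (z ℤ./ℕ 2)
parity-split z = trans (ℤDM.a≡a%ℕn+[a/ℕn]*n z 2) (by-remainder (z ℤ.%ℕ 2) (ℤDM.n%ℕd<d z 2))
  where
  by-remainder : ∀ r → r ℕ.< 2 → + r + (z ℤ./ℕ 2) * + 2 ≡ ⟦ r ℕ.≡ᵇ 1 ⟧ + + 2 * (z ℤ./ℕ 2)
  by-remainder 0 _ = cong (_+_ 0ℤ) (ℤP.*-comm (z ℤ./ℕ 2) (+ 2))
  by-remainder 1 _ = cong (_+_ 1ℤ) (ℤP.*-comm (z ℤ./ℕ 2) (+ 2))
  by-remainder (suc (suc r)) (s≤s (s≤s ()))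

odd-sum⇒NAE : ∀ {k n} → Even k → (ν : Fin n → ℤ) (x : Vec (Fin n) k) →
              (∃ λ X → ∑[ j < k ] ν (lookup x j) ≡ 1ℤ + + 2 * X) → NAE (map (parity ∘ ν) x)
odd-sum⇒NAE {k} k-even ν x (X , odd) = not-constant false , not-constant true
  where
  not-constant : ∀ b → map (parity ∘ ν) x ≢ replicate k b
  not-constant b eq = even≢odd (+ (k ℕ./ 2) * ⟦ b ⟧ + ∑[ j < k ] half j) X (begin
    + 2 * (+ (k ℕ./ 2) * ⟦ b ⟧ + ∑[ j < k ] half j)
      ≡⟨ 2[hc+s]≡[2h]c+2s (+ (k ℕ./ 2)) ⟦ b ⟧ (∑[ j < k ] half j) ⟩
    (+ 2 * + (k ℕ./ 2)) * ⟦ b ⟧ + + 2 * ∑[ j < k ] half j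
      ≡⟨ cong (λ m → m * ⟦ b ⟧ + + 2 * ∑[ j < k ] half j) 2[k/2]≡k ⟩
    + k * ⟦ b ⟧ + + 2 * ∑[ j < k ] half j
      ≡⟨ cong₂ _+_ (sym (∑-const k ⟦ b ⟧)) (*-distribˡ-sum (+ 2) half) ⟩
    ∑[ j < k ] ⟦ b ⟧ + ∑[ j < k ] (+ 2 * half j)
      ≡⟨ sym (∑-distrib-+ (λ _ → ⟦ b ⟧) (λ j → + 2 * half j)) ⟩
    ∑[ j < k ] (⟦ b ⟧ + + 2 * half j)
      ≡⟨ sum-cong-≗ (λ j → cong (λ c → ⟦ c ⟧ + + 2 * half j) (sym (parity-xⱼ j))) ⟩
    ∑[ j < k ] (⟦ parity (ν (lookup x j)) ⟧ + + 2 * (ν (lookup x j) ℤ./ℕ 2))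
      ≡⟨ sum-cong-≗ (λ j → sym (parity-split (ν (lookup x j)))) ⟩
    ∑[ j < k ] ν (lookup x j)
      ≡⟨ odd ⟩
    1ℤ + + 2 * X ∎)
    where
    half : Fin k → ℤ
    half j = ν (lookup x j) ℤ./ℕ 2
    2[hc+s]≡[2h]c+2s : ∀ h c s → + 2 * (h * c + s) ≡ (+ 2 * h) * c + + 2 * s
    2[hc+s]≡[2h]c+2s = solve-∀
    2[k/2]≡k : + 2 * + (k ℕ./ 2) ≡ + k
    2[k/2]≡k = trans (sym (ℤP.pos-* 2 (k ℕ./ 2))) (cong +_ (sym (even-split k k-even)))
    parity-xⱼ : ∀ j → parity (ν (lookup x j)) ≡ b
    parity-xⱼ j = trans (sym (lookup-map j (parity ∘ ν) x)) (trans (cong (λ v → lookup v j) eq) (lookup-replicate j b))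

∑⟨⟩-odd-weight : ∀ {k} (R : BRel k) f → (∀ a → R a ≡ true → Odd (weight a)) →
  ∑⟨ R ⟩ (λ a → + weight a * f a) ≡ ∑⟨ R ⟩ f + + 2 * ∑⟨ R ⟩ (λ a → + (weight a ℕ./ 2) * f a)
∑⟨⟩-odd-weight R f R-odd = begin
  ∑⟨ R ⟩ (λ a → + weight a * f a)
    ≡⟨ ∑⟨⟩-cong R (λ a Ra → split (weight a) (f a) (R-odd a Ra)) ⟩
  ∑⟨ R ⟩ (λ a → f a + + 2 * (+ (weight a ℕ./ 2) * f a))
    ≡⟨ ∑⟨⟩-+ R f (λ a → + 2 * (+ (weight a ℕ./ 2) * f a)) ⟩
  ∑⟨ R ⟩ f + ∑⟨ R ⟩ (λ a → + 2 * (+ (weight a ℕ./ 2) * f a))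
    ≡⟨ cong (_+_ (∑⟨ R ⟩ f)) (∑⟨⟩-* R (+ 2) (λ a → + (weight a ℕ./ 2) * f a)) ⟩
  ∑⟨ R ⟩ f + + 2 * ∑⟨ R ⟩ (λ a → + (weight a ℕ./ 2) * f a) ∎
  where
  split : ∀ w x → Odd w → + w * x ≡ x + + 2 * (+ (w ℕ./ 2) * x)
  split w x w-odd = begin
    + w * x                           ≡⟨ cong (λ n → + n * x) (odd-split w w-odd) ⟩
    + suc (2 ℕ.* (w ℕ./ 2)) * x       ≡⟨ cong (_* x) (ℤP.pos-+ 1 (2 ℕ.* (w ℕ./ 2))) ⟩
    (1ℤ + + (2 ℕ.* (w ℕ./ 2))) * x    ≡⟨ cong (λ m → (1ℤ + m) * x) (ℤP.pos-* 2 (w ℕ./ 2)) ⟩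
    (1ℤ + + 2 * + (w ℕ./ 2)) * x      ≡⟨ [1+2h]x≡x+2[hx] (+ (w ℕ./ 2)) x ⟩
    x + + 2 * (+ (w ℕ./ 2) * x)       ∎
    where
    [1+2h]x≡x+2[hx] : ∀ h x → (+ 1 + + 2 * h) * x ≡ x + + 2 * (h * x)
    [1+2h]x≡x+2[hx] = solve-∀

aip-solves-odd-weights : ∀ k t (S : Vec Bool k → Bool) →
  Odd t × Even k × (∀ a → S a ≡ true → Odd (weight a)) → AIPSolves k (IUnion k t S)
aip-solves-odd-weights k t S (t-odd , k-even , S-odd) n T (τ , ν , sol) =
  parity ∘ ν₁ , λ x Tx → odd-sum⇒NAE k-even ν₁ x (∑⟨ R ⟩ (λ a → + (weight a ℕ./ 2) * τ x a) , marginals-odd x Tx)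
  where
  open AIPSol sol
  R : BRel k
  R = IUnion k t S
  ν₁ : Fin n → ℤ
  ν₁ y = ν y true
  R-odd : ∀ a → R a ≡ true → Odd (weight a)
  R-odd a Ra with natEq (weight a) t in w≡t
  ... | true = subst Odd (sym (natEq-sound (weight a) t w≡t)) t-odd
  ... | false = S-odd a Ra
  marginals-odd : ∀ x → T x → ∑[ j < k ] ν₁ (lookup x j) ≡ 1ℤ + + 2 * ∑⟨ R ⟩ (λ a → + (weight a ℕ./ 2) * τ x a)
  marginals-odd x Tx = begin
    ∑[ j < k ] ν₁ (lookup x j)
      ≡⟨ sum-cong-≗ (λ j → sym (trans (sym (sumℤ≡∑⟨⟩ (R ⇂ j ≔ true) (τ x))) (marg x Tx j true))) ⟩
    ∑[ j < k ] ∑⟨ R ⇂ j ≔ true ⟩ (τ x)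
      ≡⟨ ∑-marginals R (τ x) ⟩
    ∑⟨ R ⟩ (λ a → + weight a * τ x a)
      ≡⟨ ∑⟨⟩-odd-weight R (τ x) R-odd ⟩
    ∑⟨ R ⟩ (τ x) + + 2 * ∑⟨ R ⟩ (λ a → + (weight a ℕ./ 2) * τ x a)
      ≡⟨ cong (_+ + 2 * ∑⟨ R ⟩ (λ a → + (weight a ℕ./ 2) * τ x a))
              (trans (sym (sumℤ≡∑⟨⟩ R (τ x))) (tau-sum x Tx)) ⟩
    1ℤ + + 2 * ∑⟨ R ⟩ (λ a → + (weight a ℕ./ 2) * τ x a) ∎

aip-accepts : ∀ {k n} (R : BRel k) (T : Vec (Fin n) k → Set) (τ : Vec (Fin n) k → Vec Bool k → ℤ) (ν : Fin n → ℤ) →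
  (∀ x → T x → ∑⟨ R ⟩ (τ x) ≡ 1ℤ) →
  (∀ x → T x → ∀ j → ∑⟨ R ⇂ j ≔ true ⟩ (τ x) ≡ ν (lookup x j)) →
  AIPAccepts R T
aip-accepts R T τ ν mass marginal = τ , ν̂ , record
  { tau-sum = λ x Tx → trans (sumℤ≡∑⟨⟩ R (τ x)) (mass x Tx)
  ; nu-sum  = λ y → [1-v]+v≡1 (ν y)
  ; marg    = marg
  }
  where
  ν̂ : _ → Bool → ℤ
  ν̂ y c = if c then ν y else 1ℤ - ν y
  [1-v]+v≡1 : ∀ v → (+ 1 - v) + v ≡ + 1
  [1-v]+v≡1 = solve-∀
  marg : ∀ x → T x → ∀ j c → sumℤ (R ⇂ j ≔ c) (τ x) ≡ ν̂ (lookup x j) c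
  marg x Tx j true = trans (sumℤ≡∑⟨⟩ (R ⇂ j ≔ true) (τ x)) (marginal x Tx j)
  marg x Tx j false = begin
    sumℤ (R ⇂ j ≔ false) (τ x)                   ≡⟨ sumℤ≡∑⟨⟩ (R ⇂ j ≔ false) (τ x) ⟩
    ∑⟨ R ⇂ j ≔ false ⟩ (τ x)                     ≡⟨ ∑⟨⇂≔false⟩ R j (τ x) ⟩
    ∑⟨ R ⟩ (τ x) - ∑⟨ R ⇂ j ≔ true ⟩ (τ x)       ≡⟨ cong₂ _-_ (mass x Tx) (marginal x Tx j) ⟩
    1ℤ - ν (lookup x j)                          ∎

fromℤ-+ : ∀ x y → fromℤ (x + y) ≡ fromℤ x ℚ.+ fromℤ y
fromℤ-+ x y = sym (trans (ℚP./-cong {p₁ = x * + 1 + y * + 1} {q₁ = 1} {p₂ = x + y} {q₂ = 1}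
                                     (cong₂ _+_ (ℤP.*-identityʳ x) (ℤP.*-identityʳ y)) refl)
                         (ℚP.↥p/↧p≡p (fromℤ (x + y))))

fromℤ-mono-≤ : ∀ {x y} → x ℤ.≤ y → fromℤ x ℚ.≤ fromℤ y
fromℤ-mono-≤ {x} {y} x≤y = ℚ.*≤* (subst₂ ℤ._≤_ (sym (ℤP.*-identityʳ x)) (sym (ℤP.*-identityʳ y)) x≤y)

scale : ℕ → ℤ → ℚ
scale z x = fromℤ x ℚ.* 1/ fromℤ (+ suc z)

module _ (z : ℕ) where

  private
    Z⁻¹ : ℚ
    Z⁻¹ = 1/ fromℤ (+ suc z)

  scale-+ : ∀ x y → scale z (x + y) ≡ scale z x ℚ.+ scale z y
  scale-+ x y = trans (cong (ℚ._* Z⁻¹) (fromℤ-+ x y)) (ℚP.*-distribʳ-+ Z⁻¹ (fromℤ x) (fromℤ y))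

  scale-self : scale z (+ suc z) ≡ 1ℚ
  scale-self = ℚP.*-inverseʳ (fromℤ (+ suc z))

  scale-mono-≤ : ∀ {x y} → x ℤ.≤ y → scale z x ℚ.≤ scale z y
  scale-mono-≤ x≤y = ℚP.*-monoʳ-≤-nonNeg Z⁻¹ (fromℤ-mono-≤ x≤y)

  scale-≢0 : ∀ x → x ≢ 0ℤ → scale z x ≢ 0ℚ
  scale-≢0 x x≢0 scaled≡0 = x≢0 (cong ℚ.↥_ (begin
    fromℤ x                                ≡⟨ sym (ℚP.*-identityʳ (fromℤ x)) ⟩
    fromℤ x ℚ.* 1ℚ                         ≡⟨ cong (fromℤ x ℚ.*_) (sym (ℚP.*-inverseˡ (fromℤ (+ suc z)))) ⟩
    fromℤ x ℚ.* (Z⁻¹ ℚ.* fromℤ (+ suc z))  ≡⟨ sym (ℚP.*-assoc (fromℤ x) Z⁻¹ (fromℤ (+ suc z))) ⟩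
    scale z x ℚ.* fromℤ (+ suc z)          ≡⟨ cong (ℚ._* fromℤ (+ suc z)) scaled≡0 ⟩
    0ℚ ℚ.* fromℤ (+ suc z)                 ≡⟨ ℚP.*-zeroˡ (fromℤ (+ suc z)) ⟩
    0ℚ                                     ∎))

  sumℚ-scale : ∀ {k} (P : BRel k) (f : Vec Bool k → ℤ) → sumℚ P (scale z ∘ f) ≡ scale z (sumℤ P f)
  sumℚ-scale {k} P f = go (allVecs k)
    where
    go : ∀ as → foldr (λ a s → if P a then scale z (f a) ℚ.+ s else s) 0ℚ as
              ≡ scale z (foldr (λ a s → if P a then f a + s else s) 0ℤ as)
    go [] = sym (ℚP.*-zeroˡ Z⁻¹)
    go (a ∷ as) with P a
    ... | true = trans (cong (scale z (f a) ℚ.+_) (go as)) (sym (scale-+ (f a) _))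
    ... | false = go as

  scale-0≤ : ∀ {x} → 0ℤ ℤ.≤ x → 0ℚ ℚ.≤ scale z x
  scale-0≤ {x} 0≤x = subst (ℚ._≤ scale z x) (ℚP.*-zeroˡ Z⁻¹) (scale-mono-≤ 0≤x)

  scale-≤1 : ∀ {x} → x ℤ.≤ + suc z → scale z x ℚ.≤ 1ℚ
  scale-≤1 {x} x≤Z = subst (scale z x ℚ.≤_) scale-self (scale-mono-≤ x≤Z)

-- A BLP solution whose support is all of R lies in the relative interior, and since it
-- is nowhere zero, the refinement it imposes on the AIP is empty.
module FullSupport {k} (R : BRel k) (W : Vec Bool k → ℤ) (z : ℕ) (M : ℤ)
  (W-mass : ∑⟨ R ⟩ W ≡ + suc z) (W-marginal : ∀ j → ∑⟨ R ⇂ j ≔ true ⟩ W ≡ M)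
  (W-pos : ∀ a → R a ≡ true → 1ℤ ℤ.≤ W a) (M-pos : 1ℤ ℤ.≤ M) (Z-M-pos : 1ℤ ℤ.≤ + suc z - M) where

  μ-weight : Bool → ℤ
  μ-weight c = if c then M else + suc z - M

  λ* : ∀ {n} → Vec (Fin n) k → Vec Bool k → ℚ
  λ* _ a = scale z (W a)

  μ* : ∀ {n} → Fin n → Bool → ℚ
  μ* _ c = scale z (μ-weight c)

  1≤μ-weight : ∀ c → 1ℤ ℤ.≤ μ-weight c
  1≤μ-weight true = M-pos
  1≤μ-weight false = Z-M-pos

  μ-weight≤Z : ∀ c → μ-weight c ℤ.≤ + suc z
  μ-weight≤Z true = ℤP.0≤i-j⇒j≤i (1≤⇒0≤ Z-M-pos)
  μ-weight≤Z false = ℤP.i-j≤i (+ suc z) M {{ℤ.nonNegative (1≤⇒0≤ M-pos)}}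

  W-marginal′ : ∀ j c → ∑⟨ R ⇂ j ≔ c ⟩ W ≡ μ-weight c
  W-marginal′ j true = W-marginal j
  W-marginal′ j false = trans (∑⟨⇂≔false⟩ R j W) (cong₂ _-_ W-mass (W-marginal j))

  blp : ∀ {n} (T : Vec (Fin n) k → Set) → BLPSol R T λ* μ*
  blp T = record
    { lam-lo  = λ x _ a Ra → scale-0≤ z (1≤⇒0≤ (W-pos a Ra))
    ; lam-hi  = λ x _ a Ra → scale-≤1 z (subst (W a ℤ.≤_) W-mass
                                               (term≤∑⟨⟩ R W (λ b Rb → 1≤⇒0≤ (W-pos b Rb)) a Ra))
    ; mu-lo   = λ y c → scale-0≤ z (1≤⇒0≤ (1≤μ-weight c))
    ; mu-hi   = λ y c → scale-≤1 z (μ-weight≤Z c)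
    ; lam-sum = λ x _ → trans (sumℚ-scale z R W) (trans (cong (scale z) (trans (sumℤ≡∑⟨⟩ R W) W-mass)) (scale-self z))
    ; mu-sum  = λ y → trans (sym (scale-+ z (+ suc z - M) M)) (trans (cong (scale z) (Z-M+M≡Z (+ suc z) M)) (scale-self z))
    ; marg    = λ x _ j c → trans (sumℚ-scale z (R ⇂ j ≔ c) W)
                                  (cong (scale z) (trans (sumℤ≡∑⟨⟩ (R ⇂ j ≔ c) W) (W-marginal′ j c)))
    }
    where
    Z-M+M≡Z : ∀ z m → (z - m) + m ≡ z
    Z-M+M≡Z = solve-∀

  λ*≢0 : ∀ {n} (x : Vec (Fin n) k) a → R a ≡ true → λ* x a ≢ 0ℚ
  λ*≢0 x a Ra = scale-≢0 z (W a) (1≤⇒≢0 (W-pos a Ra))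

  μ*≢0 : ∀ {n} (y : Fin n) c → μ* y c ≢ 0ℚ
  μ*≢0 y c = scale-≢0 z (μ-weight c) (1≤⇒≢0 (1≤μ-weight c))

  blp+aip-accepts : ∀ {n} (T : Vec (Fin n) k → Set) → AIPAccepts R T → BLPAIPAccepts R T
  blp+aip-accepts T (τ , ν , aip) =
    λ* , μ* , (blp T , λ _ _ _ → (λ x _ a Ra _ → λ*≢0 x a Ra) , (λ y c _ → μ*≢0 y c)) ,
    τ , ν , aip , (λ x _ a Ra λ≡0 → ⊥-elim (λ*≢0 x a Ra λ≡0)) , (λ y c μ≡0 → ⊥-elim (μ*≢0 y c μ≡0))

-- Moving one unit of mass from B′ p to B p moves one unit of marginal from coordinate 0 to
-- coordinate p + 1; both tuples have weight 1 + weight e, so the mass stays inside I_{t,k}.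
module Transfer {m} (e : Vec Bool m) where

  B B′ : Fin (suc m) → Vec Bool (suc (suc m))
  B p = false ∷ insertAt e p true
  B′ p = true ∷ insertAt e p false

  weight-B : ∀ p → weight (B p) ≡ suc (weight e)
  weight-B p = weight-insertAt e p true

  weight-B′ : ∀ p → weight (B′ p) ≡ suc (weight e)
  weight-B′ p = cong suc (weight-insertAt e p false)

  shift : (Fin (suc (suc m)) → ℤ) → Vec Bool (suc (suc m)) → ℤ
  shift v a = ∑[ p < suc m ] (v (suc p) * (δ (B p) a - δ (B′ p) a))

  ∑⟨⟩-shift : ∀ Q v → ∑⟨ Q ⟩ (shift v) ≡ ∑[ p < suc m ] (v (suc p) * (⟦ Q (B p) ⟧ - ⟦ Q (B′ p) ⟧))
  ∑⟨⟩-shift Q v = trans (∑⟨⟩-∑ Q (λ p a → v (suc p) * (δ (B p) a - δ (B′ p) a))) (sum-cong-≗ pair)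
    where
    pair : ∀ p → ∑⟨ Q ⟩ (λ a → v (suc p) * (δ (B p) a - δ (B′ p) a)) ≡ v (suc p) * (⟦ Q (B p) ⟧ - ⟦ Q (B′ p) ⟧)
    pair p = begin
      ∑⟨ Q ⟩ (λ a → v (suc p) * (δ (B p) a - δ (B′ p) a))
        ≡⟨ ∑⟨⟩-* Q (v (suc p)) (λ a → δ (B p) a - δ (B′ p) a) ⟩
      v (suc p) * ∑⟨ Q ⟩ (λ a → δ (B p) a + - δ (B′ p) a)
        ≡⟨ cong (v (suc p) *_) (∑⟨⟩-+ Q (δ (B p)) (λ a → - δ (B′ p) a)) ⟩
      v (suc p) * (∑⟨ Q ⟩ (δ (B p)) + ∑⟨ Q ⟩ (λ a → - δ (B′ p) a))
        ≡⟨ cong (λ s → v (suc p) * (∑⟨ Q ⟩ (δ (B p)) + s)) (∑⟨⟩-neg Q (δ (B′ p))) ⟩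
      v (suc p) * (∑⟨ Q ⟩ (δ (B p)) - ∑⟨ Q ⟩ (δ (B′ p)))
        ≡⟨ cong₂ (λ s s′ → v (suc p) * (s - s′)) (∑⟨⟩-δ Q (B p)) (∑⟨⟩-δ Q (B′ p)) ⟩
      v (suc p) * (⟦ Q (B p) ⟧ - ⟦ Q (B′ p) ⟧) ∎

  norm : (Fin (suc (suc m)) → ℤ) → ℤ
  norm v = ∑[ p < suc m ] (+ ℤ.∣ v (suc p) ∣)

  0≤norm : ∀ v → 0ℤ ℤ.≤ norm v
  0≤norm v = subst (ℤ._≤ norm v) (sum-replicate-zero (suc m)) (∑-mono-≤ (λ p → ℤ.+≤+ (ℕ.z≤n {ℤ.∣ v (suc p) ∣})))

  shift-≥ : ∀ v a → - norm v ℤ.≤ shift v a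
  shift-≥ v a = subst (ℤ._≤ shift v a) (∑-neg (λ p → + ℤ.∣ v (suc p) ∣))
    (∑-mono-≤ (λ p → -∣x∣≤x*[⟦b⟧-⟦c⟧] (v (suc p)) (a =ᵛ B p) (a =ᵛ B′ p)))

  shift-outside : ∀ (P : BRel (suc (suc m))) → (∀ p → P (B p) ≡ true) → (∀ p → P (B′ p) ≡ true) →
    ∀ v a → P a ≡ false → shift v a ≡ 0ℤ
  shift-outside P P-B P-B′ v a Pa = trans (sum-cong-≗ vanish) (sum-replicate-zero (suc m))
    where
    vanish : ∀ p → v (suc p) * (δ (B p) a - δ (B′ p) a) ≡ 0ℤ
    vanish p = trans (cong₂ (λ d d′ → v (suc p) * (d - d′))
                            (δ-outside P (B p) a (P-B p) Pa) (δ-outside P (B′ p) a (P-B′ p) Pa))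
                     (ℤP.*-zeroʳ (v (suc p)))

  ∑-transfer-marginal : ∀ v → ∑[ j < suc (suc m) ] v j ≡ 0ℤ → ∀ j →
    ∑[ p < suc m ] (v (suc p) * (⟦ lookup (B p) j ⟧ - ⟦ lookup (B′ p) j ⟧)) ≡ v j
  ∑-transfer-marginal v ∑v≡0 zero = begin
    ∑[ p < suc m ] (v (suc p) * (0ℤ - 1ℤ))   ≡⟨ sum-cong-≗ (λ p → x*[0-1]≡-x (v (suc p))) ⟩
    ∑[ p < suc m ] (- v (suc p))             ≡⟨ ∑-neg (v ∘ suc) ⟩
    - (∑[ p < suc m ] v (suc p))             ≡⟨ -s≡x ∑v≡0 ⟩
    v zero                                   ∎
    where
    x*[0-1]≡-x : ∀ x → x * (+ 0 - + 1) ≡ - x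
    x*[0-1]≡-x = solve-∀
    -s≡x : ∀ {x s} → x + s ≡ 0ℤ → - s ≡ x
    -s≡x {x} {s} x+s≡0 = trans (-s≡x-[x+s] x s) (trans (cong (_-_ x) x+s≡0) (ℤP.+-identityʳ x))
      where
      -s≡x-[x+s] : ∀ x s → - s ≡ x - (x + s)
      -s≡x-[x+s] = solve-∀
  ∑-transfer-marginal v ∑v≡0 (suc i) =
    trans (∑-point (λ p → v (suc p) * (⟦ lookup (insertAt e p true) i ⟧ - ⟦ lookup (insertAt e p false) i ⟧)) i vanish) at-i
    where
    vanish : ∀ p → p ≢ i → v (suc p) * (⟦ lookup (insertAt e p true) i ⟧ - ⟦ lookup (insertAt e p false) i ⟧) ≡ 0ℤ
    vanish p p≢i = trans (cong (λ c → v (suc p) * (⟦ c ⟧ - ⟦ lookup (insertAt e p false) i ⟧))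
                               (lookup-insertAt-≢ e p i true false p≢i))
                         (trans (cong (v (suc p) *_) (ℤP.+-inverseʳ ⟦ lookup (insertAt e p false) i ⟧)) (ℤP.*-zeroʳ (v (suc p))))
    at-i : v (suc i) * (⟦ lookup (insertAt e i true) i ⟧ - ⟦ lookup (insertAt e i false) i ⟧) ≡ v (suc i)
    at-i rewrite insertAt-lookup e i true | insertAt-lookup e i false = ℤP.*-identityʳ (v (suc i))

  module _ (R : BRel (suc (suc m))) (R-B : ∀ p → R (B p) ≡ true) (R-B′ : ∀ p → R (B′ p) ≡ true) where

    shift-mass : ∀ v → ∑⟨ R ⟩ (shift v) ≡ 0ℤ
    shift-mass v = trans (∑⟨⟩-shift R v) (trans (sum-cong-≗ vanish) (sum-replicate-zero (suc m)))
      where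
      vanish : ∀ p → v (suc p) * (⟦ R (B p) ⟧ - ⟦ R (B′ p) ⟧) ≡ 0ℤ
      vanish p rewrite R-B p | R-B′ p = ℤP.*-zeroʳ (v (suc p))

    shift-marginal : ∀ v → ∑[ j < suc (suc m) ] v j ≡ 0ℤ → ∀ j → ∑⟨ R ⇂ j ≔ true ⟩ (shift v) ≡ v j
    shift-marginal v ∑v≡0 j = begin
      ∑⟨ R ⇂ j ≔ true ⟩ (shift v)
        ≡⟨ ∑⟨⟩-shift (R ⇂ j ≔ true) v ⟩
      ∑[ p < suc m ] (v (suc p) * (⟦ (R ⇂ j ≔ true) (B p) ⟧ - ⟦ (R ⇂ j ≔ true) (B′ p) ⟧))
        ≡⟨ sum-cong-≗ (λ p → cong₂ (λ c c′ → v (suc p) * (c - c′))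
                                   (⟦⇂≔true⟧ R j (B p) (R-B p)) (⟦⇂≔true⟧ R j (B′ p) (R-B′ p))) ⟩
      ∑[ p < suc m ] (v (suc p) * (⟦ lookup (B p) j ⟧ - ⟦ lookup (B′ p) j ⟧))
        ≡⟨ ∑-transfer-marginal v ∑v≡0 j ⟩
      v j ∎

¬NAE-replicate : ∀ {k} b → ¬ NAE (replicate k b)
¬NAE-replicate true (_ , ≢all-true) = ≢all-true refl
¬NAE-replicate false (≢all-false , _) = ≢all-false refl

¬NAE-blocks : ∀ {A : Set} (f : A → Bool) k i a b → f a ≡ f b → ¬ NAE (map f (blocks k i a b))
¬NAE-blocks f k i a b fa≡fb = subst (λ v → ¬ NAE v) (sym (map-blocks-constant f k i a b fa≡fb)) (¬NAE-replicate (f b))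

pigeonhole : ∀ (x y z : Bool) → y ≡ x ⊎ z ≡ x ⊎ z ≡ y
pigeonhole true true _ = inj₁ refl
pigeonhole false false _ = inj₁ refl
pigeonhole true false true = inj₂ (inj₁ refl)
pigeonhole false true false = inj₂ (inj₁ refl)
pigeonhole true false false = inj₂ (inj₂ refl)
pigeonhole false true true = inj₂ (inj₂ refl)

Triangle : ∀ k → ℕ → ℕ → ℕ → Vec (Fin 3) k → Set
Triangle k i₁₀ i₂₀ i₂₁ x = x ≡ blocks k i₁₀ 1F 0F ⊎ x ≡ blocks k i₂₀ 2F 0F ⊎ x ≡ blocks k i₂₁ 2F 1F

triangle-↛NAE : ∀ k i₁₀ i₂₀ i₂₁ → ¬ HomToNAE (Triangle k i₁₀ i₂₀ i₂₁)
triangle-↛NAE k i₁₀ i₂₀ i₂₁ (f , hom) with pigeonhole (f 0F) (f 1F) (f 2F)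
... | inj₁ f1≡f0 = ¬NAE-blocks f k i₁₀ 1F 0F f1≡f0 (hom _ (inj₁ refl))
... | inj₂ (inj₁ f2≡f0) = ¬NAE-blocks f k i₂₀ 2F 0F f2≡f0 (hom _ (inj₂ (inj₁ refl)))
... | inj₂ (inj₂ f2≡f1) = ¬NAE-blocks f k i₂₁ 2F 1F f2≡f1 (hom _ (inj₂ (inj₂ refl)))

module NotSolved {m} (e : Vec Bool m) (t : ℕ) (1+∣e∣≡t : suc (weight e) ≡ t) (S : Vec Bool (suc (suc m)) → Bool) where
  open Transfer e

  k : ℕ
  k = suc (suc m)

  I R : BRel k
  I a = natEq (weight a) t
  R = IUnion k t S

  I-B : ∀ p → I (B p) ≡ true
  I-B p rewrite weight-B p | 1+∣e∣≡t = natEq-refl t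

  I-B′ : ∀ p → I (B′ p) ≡ true
  I-B′ p rewrite weight-B′ p | 1+∣e∣≡t = natEq-refl t

  R-I : ∀ a → I a ≡ true → R a ≡ true
  R-I a Ia = cong (_∨ S a) Ia

  R-B : ∀ p → R (B p) ≡ true
  R-B p = R-I (B p) (I-B p)

  R-B′ : ∀ p → R (B′ p) ≡ true
  R-B′ p = R-I (B′ p) (I-B′ p)

  t≤k : t ≤ k
  t≤k = subst (_≤ k) 1+∣e∣≡t (ℕP.m≤n⇒m≤1+n (s≤s (weight≤ e)))

  N : Fin k → ℤ
  N j = ∑⟨ R ⇂ j ≔ true ⟩ (⟦_⟧ ∘ S)

  u : Fin k → ℤ
  u j = ∑[ i < k ] N i - + k * N j

  ∑u≡0 : ∑[ j < k ] u j ≡ 0ℤ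
  ∑u≡0 = begin
    ∑[ j < k ] (∑N + - (+ k * N j))         ≡⟨ ∑-distrib-+ (λ _ → ∑N) (λ j → - (+ k * N j)) ⟩
    ∑[ j < k ] ∑N + ∑[ j < k ] (- (+ k * N j)) ≡⟨ cong₂ _+_ (∑-const k ∑N) (∑-neg (λ j → + k * N j)) ⟩
    + k * ∑N - ∑[ j < k ] (+ k * N j)       ≡⟨ cong (λ s → + k * ∑N - s) (sym (*-distribˡ-sum (+ k) N)) ⟩
    + k * ∑N - + k * ∑N                     ≡⟨ ℤP.+-inverseʳ (+ k * ∑N) ⟩
    0ℤ                                      ∎
    where
    ∑N : ℤ
    ∑N = ∑[ i < k ] N i

  L : ℤ
  L = 1ℤ + norm u

  -- The weight-t part is scaled by L so that it dominates the negative entries of shift u.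
  W : Vec Bool k → ℤ
  W a = + k * (L * ⟦ I a ⟧ + ⟦ S a ⟧) + shift u a

  ∑⟨⟩-W : ∀ Q → ∑⟨ Q ⟩ W ≡ + k * (L * ∑⟨ Q ⟩ (⟦_⟧ ∘ I) + ∑⟨ Q ⟩ (⟦_⟧ ∘ S)) + ∑⟨ Q ⟩ (shift u)
  ∑⟨⟩-W Q = begin
    ∑⟨ Q ⟩ W
      ≡⟨ ∑⟨⟩-+ Q (λ a → + k * (L * ⟦ I a ⟧ + ⟦ S a ⟧)) (shift u) ⟩
    ∑⟨ Q ⟩ (λ a → + k * (L * ⟦ I a ⟧ + ⟦ S a ⟧)) + ∑⟨ Q ⟩ (shift u)
      ≡⟨ cong (_+ ∑⟨ Q ⟩ (shift u)) (∑⟨⟩-* Q (+ k) (λ a → L * ⟦ I a ⟧ + ⟦ S a ⟧)) ⟩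
    + k * ∑⟨ Q ⟩ (λ a → L * ⟦ I a ⟧ + ⟦ S a ⟧) + ∑⟨ Q ⟩ (shift u)
      ≡⟨ cong (λ s → + k * s + ∑⟨ Q ⟩ (shift u)) (∑⟨⟩-+ Q (λ a → L * ⟦ I a ⟧) (⟦_⟧ ∘ S)) ⟩
    + k * (∑⟨ Q ⟩ (λ a → L * ⟦ I a ⟧) + ∑⟨ Q ⟩ (⟦_⟧ ∘ S)) + ∑⟨ Q ⟩ (shift u)
      ≡⟨ cong (λ s → + k * (s + ∑⟨ Q ⟩ (⟦_⟧ ∘ S)) + ∑⟨ Q ⟩ (shift u)) (∑⟨⟩-* Q L (⟦_⟧ ∘ I)) ⟩
    + k * (L * ∑⟨ Q ⟩ (⟦_⟧ ∘ I) + ∑⟨ Q ⟩ (⟦_⟧ ∘ S)) + ∑⟨ Q ⟩ (shift u) ∎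

  C : ℤ
  C = ∑ᵛ {suc m} (λ b → ⟦ natEq (suc (weight b)) t ⟧)

  I-marginal : ∀ j → ∑⟨ R ⇂ j ≔ true ⟩ (⟦_⟧ ∘ I) ≡ C
  I-marginal j = trans (∑ᵛ-cong pointwise) (∑-ones-symmetric (λ w → natEq w t) j)
    where
    pointwise : ∀ a → ⟦ (R ⇂ j ≔ true) a ⟧ * ⟦ I a ⟧ ≡ ⟦ lookup a j ∧ I a ⟧
    pointwise a with I a | lookup a j
    ... | true | true = refl
    ... | true | false = refl
    ... | false | true = ℤP.*-zeroʳ ⟦ S a ∧ beq true true ⟧
    ... | false | false = ℤP.*-zeroʳ ⟦ S a ∧ beq false true ⟧

  M : ℤ
  M = + k * (L * C) + ∑[ i < k ] N i

  W-marginal : ∀ j → ∑⟨ R ⇂ j ≔ true ⟩ W ≡ M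
  W-marginal j = begin
    ∑⟨ R ⇂ j ≔ true ⟩ W
      ≡⟨ ∑⟨⟩-W (R ⇂ j ≔ true) ⟩
    + k * (L * ∑⟨ R ⇂ j ≔ true ⟩ (⟦_⟧ ∘ I) + N j) + ∑⟨ R ⇂ j ≔ true ⟩ (shift u)
      ≡⟨ cong₂ (λ c s → + k * (L * c + N j) + s) (I-marginal j) (shift-marginal R R-B R-B′ u ∑u≡0 j) ⟩
    + k * (L * C + N j) + (∑[ i < k ] N i - + k * N j)
      ≡⟨ k[LC+n]+[s-kn]≡k[LC]+s (+ k) (L * C) (N j) (∑[ i < k ] N i) ⟩
    M ∎
    where
    k[LC+n]+[s-kn]≡k[LC]+s : ∀ k c n s → k * (c + n) + (s - k * n) ≡ k * c + s
    k[LC+n]+[s-kn]≡k[LC]+s = solve-∀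

  W-pos : ∀ a → R a ≡ true → 1ℤ ℤ.≤ W a
  W-pos a Ra with I a in Ia
  ... | true =
    ℤP.≤-trans (ℤP.≤-reflexive (1≡[1+n]-n (norm u)))
      (ℤP.≤-trans (ℤP.+-mono-≤ L≤x (shift-≥ u a))
                  (ℤP.+-monoˡ-≤ (shift u a) (i≤[1+k]*i (suc m) 0≤x)))
    where
    x : ℤ
    x = L * 1ℤ + ⟦ S a ⟧
    1≡[1+n]-n : ∀ n → + 1 ≡ (+ 1 + n) - n
    1≡[1+n]-n = solve-∀
    0≤⟦S⟧ : 0ℤ ℤ.≤ ⟦ S a ⟧
    0≤⟦S⟧ = 0≤⟦⟧ (S a)
    L≤x : L ℤ.≤ x
    L≤x = subst (ℤ._≤ x) (ℤP.*-identityʳ L) (ℤP.i≤i+j (L * 1ℤ) ⟦ S a ⟧ {{ℤ.nonNegative 0≤⟦S⟧}})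
    0≤x : 0ℤ ℤ.≤ x
    0≤x = ℤP.≤-trans (ℤP.+-mono-≤ (ℤ.+≤+ ℕ.z≤n) (0≤norm u)) L≤x
  ... | false = subst (1ℤ ℤ.≤_) (sym W≡k) (ℤ.+≤+ (s≤s ℕ.z≤n))
    where
    k[L*0+1]+0≡k : ∀ k L → k * (L * + 0 + + 1) + + 0 ≡ k
    k[L*0+1]+0≡k = solve-∀
    W≡k : + k * (L * 0ℤ + ⟦ S a ⟧) + shift u a ≡ + k
    W≡k = trans (cong₂ (λ s sh → + k * (L * 0ℤ + ⟦ s ⟧) + sh) Ra (shift-outside I I-B I-B′ u a Ia))
                (k[L*0+1]+0≡k (+ k) L)

  1≤∑⟨⟩W : ∀ Q → (∀ a → Q a ≡ true → R a ≡ true) → ∀ b → Q b ≡ true → 1ℤ ℤ.≤ ∑⟨ Q ⟩ W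
  1≤∑⟨⟩W Q Q⊆R b Qb =
    ℤP.≤-trans (W-pos b (Q⊆R b Qb)) (term≤∑⟨⟩ Q W (λ a Qa → 1≤⇒0≤ (W-pos a (Q⊆R a Qa))) b Qb)

  1≤mass : 1ℤ ℤ.≤ ∑⟨ R ⟩ W
  1≤mass = 1≤∑⟨⟩W R (λ _ Ra → Ra) (B 0F) (R-B 0F)

  1≤M : 1ℤ ℤ.≤ M
  1≤M = subst (1ℤ ℤ.≤_) (W-marginal 0F)
              (1≤∑⟨⟩W (R ⇂ 0F ≔ true) (⇂≔-⊆ R 0F true) (B′ 0F) (cong (_∧ true) (R-B′ 0F)))

  1≤mass-M : 1ℤ ℤ.≤ ∑⟨ R ⟩ W - M
  1≤mass-M = subst (1ℤ ℤ.≤_) (trans (∑⟨⇂≔false⟩ R 0F W) (cong (_-_ (∑⟨ R ⟩ W)) (W-marginal 0F)))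
                   (1≤∑⟨⟩W (R ⇂ 0F ≔ false) (⇂≔-⊆ R 0F false) (B 0F) (cong (_∧ true) (R-B 0F)))

  blp+aip-accepts-all : ∀ {n} (T : Vec (Fin n) k → Set) → AIPAccepts R T → BLPAIPAccepts R T
  blp+aip-accepts-all =
    FullSupport.blp+aip-accepts R W z M mass≡Z W-marginal W-pos 1≤M (subst (λ Z → 1ℤ ℤ.≤ Z - M) mass≡Z 1≤mass-M)
    where
    z : ℕ
    z = proj₁ (1≤⇒suc 1≤mass)
    mass≡Z : ∑⟨ R ⟩ W ≡ + suc z
    mass≡Z = proj₂ (1≤⇒suc 1≤mass)

  module Witness (s : Vec Bool k) (Ss : S s ≡ true) (∣s∣≢t : weight s ≢ t) where

    d : ℤ
    d = + weight s - + t

    R-s : R s ≡ true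
    R-s = trans (cong (I s ∨_) Ss) (∨-zeroʳ (I s))

    b₀ : Vec Bool k
    b₀ = B 0F

    β : ℤ → Fin k → ℤ
    β μ j = (1ℤ - μ) * ⟦ lookup b₀ j ⟧ + μ * ⟦ lookup s j ⟧

    ∑β : ∀ μ → ∑[ j < k ] β μ j ≡ (1ℤ - μ) * + t + μ * + weight s
    ∑β μ = begin
      ∑[ j < k ] β μ j
        ≡⟨ ∑-distrib-+ (λ j → (1ℤ - μ) * ⟦ lookup b₀ j ⟧) (λ j → μ * ⟦ lookup s j ⟧) ⟩
      ∑[ j < k ] ((1ℤ - μ) * ⟦ lookup b₀ j ⟧) + ∑[ j < k ] (μ * ⟦ lookup s j ⟧)
        ≡⟨ cong₂ _+_ (sym (*-distribˡ-sum (1ℤ - μ) (λ j → ⟦ lookup b₀ j ⟧)))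
                     (sym (*-distribˡ-sum μ (λ j → ⟦ lookup s j ⟧))) ⟩
      (1ℤ - μ) * ∑[ j < k ] ⟦ lookup b₀ j ⟧ + μ * ∑[ j < k ] ⟦ lookup s j ⟧
        ≡⟨ cong₂ (λ x y → (1ℤ - μ) * x + μ * y)
                 (trans (∑-weight b₀) (cong +_ (trans (weight-B 0F) 1+∣e∣≡t))) (∑-weight s) ⟩
      (1ℤ - μ) * + t + μ * + weight s ∎

    correction : ℤ → (Fin k → ℤ) → Fin k → ℤ
    correction μ v j = v j - β μ j

    -- An integer combination of δ b₀ and δ s fixes the sum of the marginals, and shift corrects the individual ones.
    τ : ℤ → (Fin k → ℤ) → Vec Bool k → ℤ
    τ μ v a = (1ℤ - μ) * δ b₀ a + μ * δ s a + shift (correction μ v) a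

    ∑⟨⟩-τ : ∀ Q μ v →
      ∑⟨ Q ⟩ (τ μ v) ≡ (1ℤ - μ) * ⟦ Q b₀ ⟧ + μ * ⟦ Q s ⟧ + ∑⟨ Q ⟩ (shift (correction μ v))
    ∑⟨⟩-τ Q μ v = begin
      ∑⟨ Q ⟩ (τ μ v)
        ≡⟨ ∑⟨⟩-+ Q (λ a → (1ℤ - μ) * δ b₀ a + μ * δ s a) (shift (correction μ v)) ⟩
      ∑⟨ Q ⟩ (λ a → (1ℤ - μ) * δ b₀ a + μ * δ s a) + ∑⟨ Q ⟩ (shift (correction μ v))
        ≡⟨ cong (_+ ∑⟨ Q ⟩ (shift (correction μ v)))
                (∑⟨⟩-+ Q (λ a → (1ℤ - μ) * δ b₀ a) (λ a → μ * δ s a)) ⟩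
      ∑⟨ Q ⟩ (λ a → (1ℤ - μ) * δ b₀ a) + ∑⟨ Q ⟩ (λ a → μ * δ s a) + ∑⟨ Q ⟩ (shift (correction μ v))
        ≡⟨ cong (_+ ∑⟨ Q ⟩ (shift (correction μ v)))
                (cong₂ _+_ (∑⟨⟩-* Q (1ℤ - μ) (δ b₀)) (∑⟨⟩-* Q μ (δ s))) ⟩
      (1ℤ - μ) * ∑⟨ Q ⟩ (δ b₀) + μ * ∑⟨ Q ⟩ (δ s) + ∑⟨ Q ⟩ (shift (correction μ v))
        ≡⟨ cong (_+ ∑⟨ Q ⟩ (shift (correction μ v)))
                (cong₂ (λ x y → (1ℤ - μ) * x + μ * y) (∑⟨⟩-δ Q b₀) (∑⟨⟩-δ Q s)) ⟩
      (1ℤ - μ) * ⟦ Q b₀ ⟧ + μ * ⟦ Q s ⟧ + ∑⟨ Q ⟩ (shift (correction μ v)) ∎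

    τ-mass : ∀ μ v → ∑⟨ R ⟩ (τ μ v) ≡ 1ℤ
    τ-mass μ v = begin
      ∑⟨ R ⟩ (τ μ v)
        ≡⟨ ∑⟨⟩-τ R μ v ⟩
      (1ℤ - μ) * ⟦ R b₀ ⟧ + μ * ⟦ R s ⟧ + ∑⟨ R ⟩ (shift (correction μ v))
        ≡⟨ cong₂ (λ x y → (1ℤ - μ) * ⟦ x ⟧ + μ * ⟦ y ⟧ + ∑⟨ R ⟩ (shift (correction μ v))) (R-B 0F) R-s ⟩
      (1ℤ - μ) * 1ℤ + μ * 1ℤ + ∑⟨ R ⟩ (shift (correction μ v))
        ≡⟨ cong (λ x → (1ℤ - μ) * 1ℤ + μ * 1ℤ + x) (shift-mass R R-B R-B′ (correction μ v)) ⟩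
      (1ℤ - μ) * 1ℤ + μ * 1ℤ + 0ℤ
        ≡⟨ [1-μ]+μ+0≡1 μ ⟩
      1ℤ ∎
      where
      [1-μ]+μ+0≡1 : ∀ μ → (+ 1 - μ) * + 1 + μ * + 1 + + 0 ≡ + 1
      [1-μ]+μ+0≡1 = solve-∀

    τ-marginal : ∀ μ v → ∑[ j < k ] v j ≡ + t + μ * d → ∀ j → ∑⟨ R ⇂ j ≔ true ⟩ (τ μ v) ≡ v j
    τ-marginal μ v ∑v≡t+μd j = begin
      ∑⟨ R ⇂ j ≔ true ⟩ (τ μ v)
        ≡⟨ ∑⟨⟩-τ (R ⇂ j ≔ true) μ v ⟩
      (1ℤ - μ) * ⟦ (R ⇂ j ≔ true) b₀ ⟧ + μ * ⟦ (R ⇂ j ≔ true) s ⟧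
        + ∑⟨ R ⇂ j ≔ true ⟩ (shift (correction μ v))
        ≡⟨ cong₂ (λ x y → (1ℤ - μ) * x + μ * y + ∑⟨ R ⇂ j ≔ true ⟩ (shift (correction μ v)))
                 (⟦⇂≔true⟧ R j b₀ (R-B 0F)) (⟦⇂≔true⟧ R j s R-s) ⟩
      β μ j + ∑⟨ R ⇂ j ≔ true ⟩ (shift (correction μ v))
        ≡⟨ cong (_+_ (β μ j)) (shift-marginal R R-B R-B′ (correction μ v) ∑[v-β]≡0 j) ⟩
      β μ j + (v j - β μ j)
        ≡⟨ b+[x-b]≡x (β μ j) (v j) ⟩
      v j ∎
      where
      b+[x-b]≡x : ∀ b x → b + (x - b) ≡ x
      b+[x-b]≡x = solve-∀
      t+μ[w-t]-[[1-μ]t+μw]≡0 : ∀ t w μ → (t + μ * (w - t)) - ((+ 1 - μ) * t + μ * w) ≡ + 0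
      t+μ[w-t]-[[1-μ]t+μw]≡0 = solve-∀
      ∑[v-β]≡0 : ∑[ j < k ] (v j - β μ j) ≡ 0ℤ
      ∑[v-β]≡0 = begin
        ∑[ j < k ] (v j - β μ j)                     ≡⟨ ∑-distrib-+ v (λ j → - β μ j) ⟩
        ∑[ j < k ] v j + ∑[ j < k ] (- β μ j)        ≡⟨ cong₂ _+_ ∑v≡t+μd (∑-neg (β μ)) ⟩
        (+ t + μ * d) - ∑[ j < k ] β μ j             ≡⟨ cong (_-_ (+ t + μ * d)) (∑β μ) ⟩
        (+ t + μ * d) - ((1ℤ - μ) * + t + μ * + weight s) ≡⟨ t+μ[w-t]-[[1-μ]t+μw]≡0 (+ t) (+ weight s) μ ⟩
        0ℤ                                           ∎

    d≢0 : d ≢ 0ℤ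
    d≢0 d≡0 = ∣s∣≢t (ℤP.+-injective (trans (w≡[w-t]+t (+ weight s) (+ t))
                                           (trans (cong (_+ + t) d≡0) (ℤP.+-identityˡ (+ t)))))
      where
      w≡[w-t]+t : ∀ w t → w ≡ (w - t) + t
      w≡[w-t]+t = solve-∀

    ∣d∣≤k : ℤ.∣ d ∣ ≤ k
    ∣d∣≤k = subst (_≤ k) (cong ℤ.∣_∣ (sym (ℤP.m-n≡m⊖n (weight s) t)))
                  (ℕP.≤-trans (ℤP.∣m⊝n∣≤m⊔n (weight s) t) (ℕP.⊔-lub (weight≤ s) t≤k))

    residue : ∀ r → ∃ λ i → i ≤ k × d ∣ + i - r
    residue r = i , ℕP.≤-trans (ℕP.<⇒≤ (ℤDM.n%d<d r d {{d-nonZero}})) ∣d∣≤k , divides (- q) i-r≡-q*d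
      where
      d-nonZero : ℤ.NonZero d
      d-nonZero = ℤ.≢-nonZero d≢0
      i : ℕ
      i = ℤ._%_ r d {{d-nonZero}}
      q : ℤ
      q = ℤ._/_ r d {{d-nonZero}}
      i-[i+q*d]≡-q*d : ∀ i q d → i - (i + q * d) ≡ - q * d
      i-[i+q*d]≡-q*d = solve-∀
      i-r≡-q*d : + i - r ≡ - q * d
      i-r≡-q*d = trans (cong (_-_ (+ i)) (ℤDM.a≡a%n+[a/n]*n r d {{d-nonZero}})) (i-[i+q*d]≡-q*d (+ i) q d)

    aip-accepts-congruent : ∀ {n} (T : Vec (Fin n) k → Set) (ν : Fin n → ℤ) →
      (∀ x → T x → d ∣ ∑[ j < k ] ν (lookup x j) - + t) → AIPAccepts R T
    aip-accepts-congruent {n} T ν congruent =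
      aip-accepts R T (λ x → τ (multiplier x) (ν ∘ lookup x)) ν
                  (λ x _ → τ-mass (multiplier x) (ν ∘ lookup x))
                  (λ x Tx → τ-marginal (multiplier x) (ν ∘ lookup x) (σ≡t+μd x Tx))
      where
      σ : Vec (Fin n) k → ℤ
      σ x = ∑[ j < k ] ν (lookup x j)
      -- The value on tuples whose sum is not congruent to t is irrelevant.
      quotient-or-0 : ∀ {z} → Dec (d ∣ z) → ℤ
      quotient-or-0 (yes d∣z) = quotient d∣z
      quotient-or-0 (no _) = 0ℤ
      multiplier : Vec (Fin n) k → ℤ
      multiplier x = quotient-or-0 (d ∣? σ x - + t)
      σ≡t+[σ-t] : ∀ σ t → σ ≡ t + (σ - t)
      σ≡t+[σ-t] = solve-∀
      σ≡t+μd : ∀ x → T x → σ x ≡ + t + multiplier x * d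
      σ≡t+μd x Tx with d ∣? σ x - + t
      ... | yes (divides q σ-t≡q*d) = trans (σ≡t+[σ-t] (σ x) (+ t)) (cong (_+_ (+ t)) σ-t≡q*d)
      ... | no d∤σ-t = ⊥-elim (d∤σ-t (congruent x Tx))

    not-solved : ∀ (c : ℤ) h → h ≤ k → d ∣ + k * c + + 2 * + h - + t → ¬ BLPAIPSolves k R
    not-solved c h h≤k d∣kc+2h-t solves =
      triangle-↛NAE k i₁₀ h i₂₁
        (solves 3 (Triangle k i₁₀ h i₂₁) (blp+aip-accepts-all _ (aip-accepts-congruent _ ν congruent)))
      where
      ν : Fin 3 → ℤ
      ν y = c + + toℕ y
      i₁₀ i₂₁ : ℕ
      i₁₀ = proj₁ (residue (+ t - + k * c))
      i₂₁ = proj₁ (residue (+ t - + k * (c + 1ℤ)))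
      blocks-congruent : ∀ a b {i} → i ≤ k → d ∣ + k * ν b + + i * (ν a - ν b) - + t →
        d ∣ ∑[ j < k ] ν (lookup (blocks k i a b) j) - + t
      blocks-congruent a b i≤k = subst (λ σ → d ∣ σ - + t) (sym (∑-blocks ν a b i≤k))
      congruent : ∀ x → Triangle k i₁₀ h i₂₁ x → d ∣ ∑[ j < k ] ν (lookup x j) - + t
      congruent _ (inj₁ refl) = blocks-congruent 1F 0F (proj₁ (proj₂ (residue (+ t - + k * c))))
        (subst (d ∣_) (sym (edge₁₀ (+ k) c (+ i₁₀) (+ t))) (proj₂ (proj₂ (residue (+ t - + k * c)))))
        where
        edge₁₀ : ∀ k c i t → k * (c + + 0) + i * ((c + + 1) - (c + + 0)) - t ≡ i - (t - k * c)
        edge₁₀ = solve-∀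
      congruent _ (inj₂ (inj₁ refl)) = blocks-congruent 2F 0F h≤k
        (subst (d ∣_) (sym (edge₂₀ (+ k) c (+ h) (+ t))) d∣kc+2h-t)
        where
        edge₂₀ : ∀ k c h t → k * (c + + 0) + h * ((c + + 2) - (c + + 0)) - t ≡ k * c + + 2 * h - t
        edge₂₀ = solve-∀
      congruent _ (inj₂ (inj₂ refl)) = blocks-congruent 2F 1F (proj₁ (proj₂ (residue (+ t - + k * (c + 1ℤ)))))
        (subst (d ∣_) (sym (edge₂₁ (+ k) c (+ i₂₁) (+ t))) (proj₂ (proj₂ (residue (+ t - + k * (c + 1ℤ))))))
        where
        edge₂₁ : ∀ k c i t → k * (c + + 1) + i * ((c + + 2) - (c + + 1)) - t ≡ i - (t - k * (c + + 1))
        edge₂₁ = solve-∀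

    not-solved-if-even-t : Even t → ¬ BLPAIPSolves k R
    not-solved-if-even-t t-even = not-solved 0ℤ (t ℕ./ 2) (ℕP.≤-trans (ℕDM.m/n≤m t 2) t≤k)
      (subst (d ∣_) (sym (trans (cong (λ x → + k * 0ℤ + x - + t) (2*[n/2]≡n t t-even)) (k*0+t-t≡0 (+ k) (+ t))))
                    (divides 0ℤ refl))
      where
      k*0+t-t≡0 : ∀ k t → k * + 0 + t - t ≡ + 0
      k*0+t-t≡0 = solve-∀

    not-solved-if-even-s : Even (weight s) → ¬ BLPAIPSolves k R
    not-solved-if-even-s s-even = not-solved 0ℤ (weight s ℕ./ 2) (ℕP.≤-trans (ℕDM.m/n≤m (weight s) 2) (weight≤ s))
      (subst (d ∣_) (sym (trans (cong (λ x → + k * 0ℤ + x - + t) (2*[n/2]≡n (weight s) s-even))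
                                (k*0+w-t≡w-t (+ k) (+ weight s) (+ t))))
                    ∣-refl)
      where
      k*0+w-t≡w-t : ∀ k w t → k * + 0 + w - t ≡ w - t
      k*0+w-t≡w-t = solve-∀

    not-solved-if-odd-k-t : Odd k → Odd t → ¬ BLPAIPSolves k R
    not-solved-if-odd-k-t k-odd t-odd = not-solved ℤ.-1ℤ h h≤k
      (subst (d ∣_) (sym (trans (cong (λ x → + k * ℤ.-1ℤ + x - + t) 2h≡k+t) (-k+[k+t]-t≡0 (+ k) (+ t)))) (divides 0ℤ refl))
      where
      h : ℕ
      h = (k ℕ.+ t) ℕ./ 2
      k+t-even : Even (k ℕ.+ t)
      k+t-even = trans (ℕDM.%-distribˡ-+ k t 2) (cong₂ (λ x y → (x ℕ.+ y) ℕ.% 2) k-odd t-odd)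
      2h≡k+t : + 2 * + h ≡ + k + + t
      2h≡k+t = trans (2*[n/2]≡n (k ℕ.+ t) k+t-even) (ℤP.pos-+ k t)
      h≤k : h ≤ k
      h≤k = ℕP.*-cancelˡ-≤ 2 (subst₂ _≤_ (even-split (k ℕ.+ t) k+t-even) (cong (k ℕ.+_) (sym (ℕP.+-identityʳ k)))
                                      (ℕP.+-monoʳ-≤ k t≤k))
      -k+[k+t]-t≡0 : ∀ k t → k * - + 1 + (k + t) - t ≡ + 0
      -k+[k+t]-t≡0 = solve-∀

  blp+aip-fails : (∃ λ s → S s ≡ true) → (∀ s → S s ≡ true → weight s ≢ t) →
    ¬ (Odd t × Even k × (∀ a → S a ≡ true → Odd (weight a))) → ¬ BLPAIPSolves k R
  blp+aip-fails (s₀ , Ss₀) S≢t ¬odd solves with even-or-odd t | even-or-odd k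
  ... | inj₁ t-even | _ = Witness.not-solved-if-even-t s₀ Ss₀ (S≢t s₀ Ss₀) t-even solves
  ... | inj₂ t-odd | inj₂ k-odd = Witness.not-solved-if-odd-k-t s₀ Ss₀ (S≢t s₀ Ss₀) k-odd t-odd solves
  ... | inj₂ t-odd | inj₁ k-even = ¬odd (t-odd , k-even , S-odd)
    where
    S-odd : ∀ a → S a ≡ true → Odd (weight a)
    S-odd a Sa with even-or-odd (weight a)
    ... | inj₂ a-odd = a-odd
    ... | inj₁ a-even = ⊥-elim (Witness.not-solved-if-even-s a Sa (S≢t a Sa) a-even solves)

theorem3p1 : (k t : ℕ) (S : Vec Bool k → Bool) →
    3 ≤ k → 1 ≤ t → t < k →
    (∃ λ a → S a ≡ true) →
    (∀ a → S a ≡ true →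
      (weight a ≢ t) × (a ≢ replicate k false) × (a ≢ replicate k true)) →
    ((Odd t × Even k × (∀ a → S a ≡ true → Odd (weight a))) →
       AIPSolves k (IUnion k t S)) ×
    (¬ (Odd t × Even k × (∀ a → S a ≡ true → Odd (weight a))) →
       ¬ BLPAIPSolves k (IUnion k t S))
theorem3p1 k zero S _ () _ _ _
theorem3p1 zero (suc t′) S _ _ () _ _
theorem3p1 (suc zero) (suc t′) S _ _ (s≤s ()) _ _
theorem3p1 (suc (suc m)) (suc t′) S _ _ (s≤s (s≤s t′≤m)) S-nonempty S-avoids =
  aip-solves-odd-weights (suc (suc m)) (suc t′) S ,
  NotSolved.blp+aip-fails (blocks m t′ true false) (suc t′) (cong suc (weight-blocks t′≤m)) S
                          S-nonempty (λ s Ss → proj₁ (S-avoids s Ss))
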